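{- Let $D=(V+r,E)$ be a finite acyclic directed graph with root node $r\notin V$. Then an edge set $F\subseteq E$ is a maximal flame in $D$ if and only if $F$ is a base of the matroid $\mathcal{M}=\bigoplus_{v\in V}\mathcal{G}_D(v)$ (the direct sum of the matroids $\mathcal{G}_D(v)$, $v\in V$, on the ground set $\bigcup_{v\in V}\operatorname{in}_D(v)$).
   Context: For a directed graph $H$ with root $r$ and vertex $v\neq r$, $\lambda_H(r,v)$ denotes the maximum number of pairwise edge-disjoint directed paths from $r$ to $v$ in $H$, and $\varrho_H(v)$ the in-degree of $v$ in $H$. Spanning subgraphs are identified with their edge sets. A maximal flame in $D=(V+r,E)$ is an edge set $F\subseteq E$ such that the spanning subgraph $(V+r,F)$ satisfies $\lambda_D(r,v)=\lambda_F(r,v)=\varrho_F(v)$ for every $v\in V$. For $v\in V$, $\mathcal{G}_D(v)$ is the matroid whose ground set is $\operatorname{in}_D(v)$, the set of edges of $D$ entering $v$, in which a subset $X\subseteq\operatorname{in}_D(v)$ is independent if and only if there exist $|X|$ pairwise edge-disjoint directed paths from $r$ to $v$ in $D$ whose last edges form exactly $X$. -}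

module Defs where

open import Data.Nat using (ℕ; zero; suc; _≤_)
open import Data.Fin using (Fin; zero; suc; _≟_)
open import Data.Fin.Subset as S using (Subset; ⊤; _∩_; ∣_∣; _⊆_; ⋃)
open import Data.List using (List; []; _∷_; map; last)
open import Data.List.Relation.Unary.All using (All)
open import Data.List.Relation.Unary.Unique.Propositional using (Unique)
open import Data.List.Relation.Binary.Disjoint.Propositional using (Disjoint)
open import Data.Maybe using (just)
open import Data.Product using (Σ; ∃; _×_)
open import Data.Vec using (tabulate)
open import Relation.Binary.PropositionalEquality using (_≡_; _≢_)
open import Relation.Nullary.Decidable using (⌊_⌋)
open import Function.Bundles using (_⇔_)
open import Data.Empty using (⊥)

-- Vertices are Fin (suc n); the root r is `zero`, and V = { suc v | v : Fin n }.
record Digraph (n m : ℕ) : Set where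
  field
    tail : Fin m → Fin (suc n)
    head : Fin m → Fin (suc n)

Vertex : ℕ → Set
Vertex n = Fin (suc n)

root : ∀ {n} → Vertex n
root = zero

module _ {n m : ℕ} (D : Digraph n m) where
  open Digraph D

  data IsWalk : Vertex n → List (Fin m) → Vertex n → Set where
    nil  : ∀ {u} → IsWalk u [] u
    cons : ∀ {u w e es} → tail e ≡ u → IsWalk (head e) es w → IsWalk u (e ∷ es) w

  Acyclic : Set
  Acyclic = ∀ u e es → IsWalk u (e ∷ es) u → ⊥

  IsPath : Vertex n → List (Fin m) → Vertex n → Set
  IsPath u es w = IsWalk u es w × Unique (u ∷ map head es)

  IsPathIn : Subset m → List (Fin m) → Vertex n → Set
  IsPathIn H es w = IsPath root es w × All (S._∈ H) es

  PathSystem : Subset m → Vertex n → (k : ℕ) → (Fin k → List (Fin m)) → Set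
  PathSystem H w k P =
    (∀ i → IsPathIn H (P i) w) × (∀ i j → i ≢ j → Disjoint (P i) (P j))

  HasPaths : Subset m → Vertex n → ℕ → Set
  HasPaths H w k = Σ (Fin k → List (Fin m)) (PathSystem H w k)

  IsLambda : Subset m → Vertex n → ℕ → Set
  IsLambda H w k = HasPaths H w k × (∀ k' → HasPaths H w k' → k' ≤ k)

  inD : Vertex n → Subset m
  inD w = tabulate (λ e → ⌊ head e ≟ w ⌋)

  indeg : Subset m → Vertex n → ℕ
  indeg H w = ∣ H ∩ inD w ∣

  E : Subset m
  E = ⊤

  MaximalFlame : Subset m → Set
  MaximalFlame F = F ⊆ E × (∀ (v : Fin n) →
    IsLambda E (suc v) (indeg F (suc v)) × IsLambda F (suc v) (indeg F (suc v)))

  IndepG : Fin n → Subset m → Set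
  IndepG v X = X ⊆ inD (suc v) ×
    Σ (Fin ∣ X ∣ → List (Fin m)) λ P →
      PathSystem E (suc v) ∣ X ∣ P ×
      (∀ e → (e S.∈ X) ⇔ (∃ λ i → last (P i) ≡ just e))

  Ground : Subset m
  Ground = ⋃ (Data.List.map (λ v → inD (suc v)) (Data.List.allFin n))
    where import Data.List

  IndepM : Subset m → Set
  IndepM X = X ⊆ Ground × (∀ v → IndepG v (X ∩ inD (suc v)))

  IsBaseM : Subset m → Set
  IsBaseM X = IndepM X × (∀ Y → IndepM Y → X ⊆ Y → Y ⊆ X)

{-# OPTIONS --safe #-}
-- A set X ⊆ in(v) is independent in 𝒢_D(v) exactly when it is linked: there are |X| edge-disjoint
-- r-v walks that enter v only through X (in an acyclic digraph walks are paths, and the last edge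
-- of a path is its only edge into v). Linked sets have at most λ_D(r,v) elements, so a maximal
-- flame F, for which every F ∩ in(v) is linked of size λ_D(r,v), is a base of ℳ.
-- Conversely let F be a base and X = F ∩ in(v). For every other edge e into v, Menger's theorem
-- (proved with augmenting walks and the decomposition of acyclic flows) and the maximality of X
-- yield a vertex set containing tail e and v but not r that is entered by at most |X| edges of the
-- graph in which v is entered only through X. Submodularity of the cut function unites these sets
-- into one that bounds every family of edge-disjoint r-v walks in D, so |X| = λ_D(r,v). Now delete
-- the edges outside F one by one. At the end
-- λ_F(r,v) = |F ∩ in(v)| = λ_D(r,v) for every v.
module Submission where

open import Defs

open import Data.Bool using (Bool; true; false; _∧_; _∨_; not; if_then_else_)
open import Data.Bool.Properties
  using (∧-zeroʳ; ∧-identityʳ; ∨-zeroʳ; ∨-identityʳ; ∧-conicalˡ; ∧-conicalʳ;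
         ¬-not; not-¬; not-involutive; not-injective)
open import Data.Empty using (⊥; ⊥-elim)
open import Data.Fin using (Fin; zero; suc; _≟_; inject≤)
open import Data.Fin.Properties as Fin using (any?; inject≤-injective)
open import Data.Fin.Subset as S using (Subset; ∣_∣)
open import Data.Fin.Subset.Properties using (∈⊤; x∈p∪q⁺)
open import Data.List using (List; []; _∷_; length; tabulate; map; _++_; allFin; last)
open import Data.List.Properties using (length-tabulate; length-map)
open import Data.List.Membership.Propositional using (_∈_; _∉_)
open import Data.List.Membership.Propositional.Properties using (∈-allFin; ∈-map⁺)
open import Data.List.Relation.Binary.Disjoint.Propositional using (Disjoint)
open import Data.List.Relation.Unary.All as All using (All; []; _∷_)
import Data.List.Relation.Unary.All.Properties as All
open import Data.List.Relation.Unary.AllPairs using ([]; _∷_)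
open import Data.List.Relation.Unary.Any using (here; there) renaming (any? to anyᴸ?)
open import Data.List.Relation.Unary.Unique.Propositional using (Unique)
import Data.List.Relation.Unary.Unique.Propositional.Properties as Unique
open import Data.Maybe using (just)
open import Data.Maybe.Properties using (just-injective)
open import Data.Nat using (ℕ; zero; suc; _+_; _≤_; _<_; z≤n; s≤s; _≤?_)
open import Data.Nat.Properties
  using (≤-refl; ≤-reflexive; ≤-trans; ≤-pred; <-irrefl; ≤-<-trans; <-≤-trans; ≰⇒>;
         m≤n⇒m≤1+n; n≤0⇒n≡0; m≤m+n;
         +-comm; +-identityʳ; +-suc; +-cancelʳ-≡; +-cancelˡ-≡; +-cancelˡ-≤; suc-injective;
         +-mono-≤; +-monoˡ-≤; +-monoʳ-≤; +-monoˡ-<; +-0-commutativeMonoid; module ≤-Reasoning)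
open import Algebra.Properties.CommutativeMonoid.Sum +-0-commutativeMonoid
  using (sum; sum-cong-≗; ∑-comm; ∑-distrib-+)
open import Data.Nat.Tactic.RingSolver using (solve-∀)
open import Data.Product using (Σ; ∃; _×_; _,_; proj₁; proj₂)
open import Data.Sum using (_⊎_; inj₁; inj₂)
open import Data.Vec using ([]; _∷_; lookup)
open import Data.Vec.Properties using ([]=⇒lookup; lookup⇒[]=; lookup∘tabulate; lookup-zipWith)
open import Function using (_∘_)
open import Function.Bundles using (_⇔_; mk⇔; Equivalence)
open import Relation.Binary.PropositionalEquality
open import Relation.Nullary using (¬_; yes; no; Dec)
open import Relation.Nullary.Decidable using (⌊_⌋; ⌊⌋-map′)

variable
  k j : ℕ

bit : Bool → ℕ
bit true  = 1
bit false = 0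

count : (Fin k → Bool) → ℕ
count p = sum (bit ∘ p)

_==_ : Fin k → Fin k → Bool
a == b = ⌊ a ≟ b ⌋

==-refl : (a : Fin k) → (a == a) ≡ true
==-refl a with a ≟ a
... | yes _  = refl
... | no a≢a = ⊥-elim (a≢a refl)

==⇒≡ : {a b : Fin k} → (a == b) ≡ true → a ≡ b
==⇒≡ {a = a} {b} _ with a ≟ b
... | yes a≡b = a≡b

≢⇒==-false : {a b : Fin k} → a ≢ b → (a == b) ≡ false
≢⇒==-false {a = a} {b} a≢b with a ≟ b
... | yes a≡b = ⊥-elim (a≢b a≡b)
... | no _    = refl

==-suc : (a b : Fin k) → _==_ {suc k} (suc a) (suc b) ≡ (a == b)
==-suc a b = ⌊⌋-map′ (cong suc) Fin.suc-injective (a ≟ b)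

≡⇒== : {a b : Fin k} → a ≡ b → (a == b) ≡ true
≡⇒== refl = ==-refl _

_⊆_ : (Fin k → Bool) → (Fin k → Bool) → Set
p ⊆ q = ∀ x → p x ≡ true → q x ≡ true

_-_ : (Fin k → Bool) → Fin k → (Fin k → Bool)
(p - x) y = p y ∧ not (y == x)

x∉p-x : (p : Fin k → Bool) (x : Fin k) → (p - x) x ≡ false
x∉p-x p x rewrite ==-refl x = ∧-zeroʳ (p x)

p-x⊆p : (p : Fin k → Bool) (x : Fin k) → (p - x) ⊆ p
p-x⊆p p x y y∈ = ∧-conicalˡ (p y) _ y∈

_∪⁅_⁆ : (Fin k → Bool) → Fin k → (Fin k → Bool)
(p ∪⁅ x ⁆) y = p y ∨ (y == x)

_∩_ : (Fin k → Bool) → (Fin k → Bool) → (Fin k → Bool)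
(p ∩ q) x = p x ∧ q x

_∪_ : (Fin k → Bool) → (Fin k → Bool) → (Fin k → Bool)
(p ∪ q) x = p x ∨ q x

count-cong : {p q : Fin k → Bool} → p ≗ q → count p ≡ count q
count-cong p≗q = sum-cong-≗ (cong bit ∘ p≗q)

sum-mono : {f g : Fin k → ℕ} → (∀ x → f x ≤ g x) → sum f ≤ sum g
sum-mono {zero}  f≤g = z≤n
sum-mono {suc k} f≤g = +-mono-≤ (f≤g zero) (sum-mono (f≤g ∘ suc))

count-mono : {p q : Fin k → Bool} → p ⊆ q → count p ≤ count q
count-mono p⊆q = sum-mono (λ x → bit-mono (p⊆q x))
  where
  bit-mono : {a b : Bool} → (a ≡ true → b ≡ true) → bit a ≤ bit b
  bit-mono {false}         _   = z≤n
  bit-mono {true}  {true}  _   = ≤-refl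
  bit-mono {true}  {false} a⇒b with () ← a⇒b refl

count≤ : (p : Fin k → Bool) → count p ≤ k
count≤ {zero}  p = z≤n
count≤ {suc k} p with p zero
... | true  = s≤s (count≤ (p ∘ suc))
... | false = m≤n⇒m≤1+n (count≤ (p ∘ suc))

count-full : count {k} (λ _ → true) ≡ k
count-full {zero}  = refl
count-full {suc k} = cong suc (count-full {k})

count-empty : (p : Fin k → Bool) → (∀ x → p x ≡ false) → count p ≡ 0
count-empty {zero}  p none = refl
count-empty {suc k} p none rewrite none zero = count-empty (p ∘ suc) (none ∘ suc)

count-∅ : count {k} (λ _ → false) ≡ 0
count-∅ {k} = count-empty {k} (λ _ → false) (λ _ → refl)

count-remove : (p : Fin k → Bool) {x : Fin k} → p x ≡ true → count p ≡ suc (count (p - x))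
count-remove {suc k} p {zero} px rewrite px =
  cong suc (count-cong (λ y → sym (∧-identityʳ (p (suc y)))))
count-remove {suc k} p {suc x} px = begin
  bit (p zero) + count (p ∘ suc)                ≡⟨ cong (bit (p zero) +_) (count-remove (p ∘ suc) px) ⟩
  bit (p zero) + suc (count ((p ∘ suc) - x))    ≡⟨ +-suc (bit (p zero)) _ ⟩
  suc (bit (p zero) + count ((p ∘ suc) - x))
    ≡⟨ cong suc (cong₂ _+_ (cong bit (∧-identityʳ (p zero))) (count-cong shift)) ⟨
  suc (count (p - suc x))                       ∎
  where
  open ≡-Reasoning
  shift : ∀ y → (p - suc x) (suc y) ≡ ((p ∘ suc) - x) y
  shift y = cong (λ b → p (suc y) ∧ not b) (==-suc y x)

count-insert : (p : Fin k → Bool) {x : Fin k} → p x ≡ false → count (p ∪⁅ x ⁆) ≡ suc (count p)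
count-insert p {x} px = trans (count-remove (p ∪⁅ x ⁆) x∈) (cong suc (count-cong removed))
  where
  x∈ : (p ∪⁅ x ⁆) x ≡ true
  x∈ rewrite ==-refl x = ∨-zeroʳ (p x)
  removed : ∀ y → ((p ∪⁅ x ⁆) - x) y ≡ p y
  removed y with y ≟ x
  ... | yes refl rewrite px = refl
  ... | no _ = trans (∧-identityʳ _) (∨-identityʳ (p y))

count-singleton : (x : Fin k) → count (_== x) ≡ 1
count-singleton {k} x = trans (count-insert {k} (λ _ → false) refl) (cong suc (count-∅ {k}))

count-pos : (p : Fin k → Bool) {x : Fin k} → p x ≡ true → 0 < count p
count-pos p px rewrite count-remove p px = s≤s z≤n

count-witness : (p : Fin k → Bool) → 0 < count p → ∃ λ x → p x ≡ true
count-witness p pos with any? (λ x → p x Data.Bool.≟ true)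
... | yes found = found
... | no none = ⊥-elim (<-irrefl refl (subst (0 <_) (count-empty p (λ x → ¬-not (none ∘ (x ,_)))) pos))

count-∩-insert : (p q : Fin k → Bool) {x : Fin k} → p x ≡ false →
  count ((p ∪⁅ x ⁆) ∩ q) ≡ bit (q x) + count (p ∩ q)
count-∩-insert p q {x} px with q x in qx
... | true  = trans (count-cong pointwise) (count-insert (p ∩ q) (cong (_∧ q x) px))
  where
  pointwise : ∀ y → ((p ∪⁅ x ⁆) ∩ q) y ≡ ((p ∩ q) ∪⁅ x ⁆) y
  pointwise y with y ≟ x
  ... | yes refl rewrite px | qx = refl
  ... | no _ = trans (cong (_∧ q y) (∨-identityʳ (p y))) (sym (∨-identityʳ _))
... | false = count-cong pointwise
  where
  pointwise : ∀ y → ((p ∪⁅ x ⁆) ∩ q) y ≡ (p ∩ q) y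
  pointwise y with y ≟ x
  ... | yes refl rewrite qx = trans (∧-zeroʳ _) (sym (∧-zeroʳ (p y)))
  ... | no _ = cong (_∧ q y) (∨-identityʳ (p y))

count-∩-remove : (p q : Fin k → Bool) {x : Fin k} → p x ≡ true →
  count (p ∩ q) ≡ bit (q x) + count ((p - x) ∩ q)
count-∩-remove p q {x} px = trans (count-cong restored) (count-∩-insert (p - x) q (x∉p-x p x))
  where
  restored : ∀ y → (p ∩ q) y ≡ (((p - x) ∪⁅ x ⁆) ∩ q) y
  restored y with y ≟ x
  ... | yes refl rewrite px = refl
  ... | no _ = cong (_∧ q y) (sym (trans (∨-identityʳ _) (∧-identityʳ (p y))))

length≤count : (p : Fin k → Bool) (xs : List (Fin k)) → Unique xs →
  All (λ x → p x ≡ true) xs → length xs ≤ count p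
length≤count p []       _            _          = z≤n
length≤count p (x ∷ xs) (x∉xs ∷ uxs) (px ∷ pxs) rewrite count-remove p px =
  s≤s (length≤count (p - x) xs uxs (All.zipWith still-in (x∉xs , pxs)))
  where
  still-in : ∀ {y} → x ≢ y × p y ≡ true → (p - x) y ≡ true
  still-in {y} (x≢y , py) rewrite py | ≢⇒==-false (x≢y ∘ sym) = refl

injective⇒≤count : (p : Fin k → Bool) (c : Fin j → Fin k) → (∀ {a b} → c a ≡ c b → a ≡ b) →
  (∀ i → p (c i) ≡ true) → j ≤ count p
injective⇒≤count p c c-inj pc = subst (_≤ count p) (length-tabulate c)
  (length≤count p (tabulate c) (Unique.tabulate⁺ c-inj) (All.tabulate⁺ pc))

p⊆q∧∣q∣≤∣p∣⇒q⊆p : {p q : Fin k → Bool} → p ⊆ q → count q ≤ count p → q ⊆ p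
p⊆q∧∣q∣≤∣p∣⇒q⊆p {p = p} {q} p⊆q ∣q∣≤∣p∣ x qx with p x in px
... | true  = refl
... | false = ⊥-elim (<-irrefl refl
  (≤-trans (subst (_≤ count p) (count-remove q qx) ∣q∣≤∣p∣) (count-mono p⊆q-x)))
  where
  p⊆q-x : ∀ y → p y ≡ true → (q - x) y ≡ true
  p⊆q-x y py with y ≟ x
  ... | yes refl with () ← trans (sym px) py
  ... | no _ rewrite p⊆q y py = refl

∈⋃ : ∀ {ps : List (Subset k)} {p x} → p ∈ ps → x S.∈ p → x S.∈ S.⋃ ps
∈⋃ (here refl) x∈p = x∈p∪q⁺ (inj₁ x∈p)
∈⋃ (there p∈)  x∈p = x∈p∪q⁺ (inj₂ (∈⋃ p∈ x∈p))

∣X∣≡count : (X : Subset k) → ∣ X ∣ ≡ count (lookup X)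
∣X∣≡count []          = refl
∣X∣≡count (true ∷ X)  = cong suc (∣X∣≡count X)
∣X∣≡count (false ∷ X) = ∣X∣≡count X

sum-point : (y : Fin k) (c : ℕ) → sum (λ x → if x == y then c else 0) ≡ c
sum-point {suc k} zero    c = trans (cong (c +_) (count-∅ {k})) (+-identityʳ c)
sum-point {suc k} (suc y) c = trans (sum-cong-≗ (λ x → cong (if_then c else 0) (==-suc x y))) (sum-point y c)

∑-count-fibres : (p : Fin k → Bool) (f : Fin k → Fin j) (U : Fin j → Bool) →
  sum (λ x → if U x then count (p ∩ λ e → f e == x) else 0) ≡ count (p ∩ (U ∘ f))
∑-count-fibres {k} {j} p f U = begin
  sum (λ x → if U x then count (p ∩ λ e → f e == x) else 0)  ≡⟨ sum-cong-≗ (λ x → guard (U x)) ⟩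
  sum (λ x → count (λ e → U x ∧ (p e ∧ (f e == x))))
    ≡⟨ ∑-comm (λ x e → bit (U x ∧ (p e ∧ (f e == x)))) ⟩
  sum (λ e → count (λ x → U x ∧ (p e ∧ (f e == x))))         ≡⟨ sum-cong-≗ fibre ⟩
  count (p ∩ (U ∘ f))                                        ∎
  where
  open ≡-Reasoning
  guard : ∀ {x} b →
    (if b then count (p ∩ λ e → f e == x) else 0) ≡ count (λ e → b ∧ (p e ∧ (f e == x)))
  guard true  = refl
  guard false = sym (count-∅ {k})
  count-point : (b : Bool) (y : Fin j) → count (λ x → b ∧ (x == y)) ≡ bit b
  count-point true  y = count-singleton y
  count-point false y = count-∅ {j}
  at-image : ∀ e x → (U x ∧ (p e ∧ (f e == x))) ≡ ((p e ∧ U (f e)) ∧ (x == f e))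
  at-image e x with x ≟ f e
  ... | yes refl rewrite ==-refl x with U x | p e
  ...   | true  | true  = refl
  ...   | true  | false = refl
  ...   | false | true  = refl
  ...   | false | false = refl
  at-image e x | no x≢fe rewrite ≢⇒==-false (x≢fe ∘ sym) =
    trans (cong (U x ∧_) (∧-zeroʳ (p e))) (trans (∧-zeroʳ (U x)) (sym (∧-zeroʳ _)))
  fibre : ∀ e → count (λ x → U x ∧ (p e ∧ (f e == x))) ≡ bit (p e ∧ U (f e))
  fibre e = trans (count-cong (at-image e)) (count-point (p e ∧ U (f e)) (f e))

module _ {n m : ℕ} (D : Digraph n m) where
  open Digraph D

  EdgeSet VertexSet : Set
  EdgeSet   = Fin m → Bool
  VertexSet = Vertex n → Bool

  private variable
    a b c v w x : Vertex n
    es fs : List (Fin m)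
    G G′ X : EdgeSet
    U : VertexSet

  -- Walks and cuts

  walk-++ : IsWalk D a es b → IsWalk D b fs c → IsWalk D a (es ++ fs) c
  walk-++ nil           q = q
  walk-++ (cons refl p) q = cons refl (walk-++ p q)

  walk-from-head : {e : Fin m} → IsWalk D a es b → e ∈ es → ∃ λ fs → IsWalk D (head e) fs b
  walk-from-head (cons refl p) (here refl) = _ , p
  walk-from-head (cons refl p) (there e∈) = walk-from-head p e∈

  walk-to-visited : IsWalk D a es b → v ∈ (a ∷ map head es) → ∃ λ fs → IsWalk D a fs v
  walk-to-visited p             (here refl) = [] , nil
  walk-to-visited (cons refl p) (there v∈)  = let fs , q = walk-to-visited p v∈ in _ , cons refl q

  enters : VertexSet → Fin m → Bool
  enters U e = not (U (tail e)) ∧ U (head e)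

  walk-enters : (U : VertexSet) → IsWalk D a es b → U a ≡ false → U b ≡ true →
    ∃ λ e → e ∈ es × enters U e ≡ true
  walk-enters U nil Ua≡false Ub≡true with () ← trans (sym Ua≡false) Ub≡true
  walk-enters U (cons {e = e} refl p) Ua≡false Ub≡true with U (head e) in Uhe
  ... | true  = e , here refl , cong₂ (λ x y → not x ∧ y) Ua≡false Uhe
  ... | false = let g , g∈ , g-enters = walk-enters U p Uhe Ub≡true in g , there g∈ , g-enters

  acyclic⇒path : Acyclic D → IsWalk D a es b → Unique (a ∷ map head es)
  acyclic⇒path acyclic nil = [] ∷ []
  acyclic⇒path {a = a} acyclic (cons {e = e} refl p) = All.tabulate a≢visited ∷ acyclic⇒path acyclic p
    where
    a≢visited : ∀ {v} → v ∈ (head e ∷ map head _) → a ≢ v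
    a≢visited v∈ refl = let _ , q = walk-to-visited p v∈ in acyclic a e _ (cons refl q)

  acyclic⇒length≤ : Acyclic D → IsWalk D a es b → length es ≤ n
  acyclic⇒length≤ {a = a} {es} acyclic p = ≤-pred (subst₂ _≤_ (cong suc (length-map head es)) (count-full {suc n})
    (length≤count (λ _ → true) (a ∷ map head es) (acyclic⇒path acyclic p) (All.universal (λ _ → refl) _)))

  acyclic⇒no-return : Acyclic D → IsWalk D a es b → a ≢ b → ¬ IsWalk D b fs a
  acyclic⇒no-return acyclic nil           a≢b _ = a≢b refl
  acyclic⇒no-return acyclic (cons refl p) _   q = acyclic _ _ _ (walk-++ (cons refl p) q)

  last-edge : ∀ {e} → IsWalk D a (e ∷ es) b →
    ∃ λ f → last (e ∷ es) ≡ just f × head f ≡ b × f ∈ (e ∷ es)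
  last-edge {e = e} (cons _ nil)      = e , refl , refl , here refl
  last-edge (cons _ (cons t p)) with last-edge (cons t p)
  ... | f , last≡f , hf≡b , f∈ = f , last≡f , hf≡b , there f∈

  path-last : ∀ {e} → IsWalk D a es b → Unique (a ∷ map head es) → e ∈ es → head e ≡ b →
    last es ≡ just e
  path-last (cons _ nil) _ (here refl) _ = refl
  path-last (cons _ (cons t p)) (_ ∷ he∉ ∷ _) (here refl) he≡b with last-edge (cons t p)
  ... | f , _ , hf≡b , f∈ = ⊥-elim (All.lookup he∉ (∈-map⁺ head f∈) (trans he≡b (sym hf≡b)))
  path-last (cons _ (cons t p)) (_ ∷ unique) (there e∈) he≡b = path-last (cons t p) unique e∈ he≡b

  record Walks (G : EdgeSet) (w : Vertex n) (k : ℕ) : Set where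
    field
      walk     : Fin k → List (Fin m)
      isWalk   : ∀ i → IsWalk D root (walk i) w
      inside   : ∀ i → All (λ e → G e ≡ true) (walk i)
      disjoint : ∀ i j → i ≢ j → Disjoint (walk i) (walk j)

  Walks-mono : G ⊆ G′ → Walks G w k → Walks G′ w k
  Walks-mono G⊆G′ P = record
    { walk = walk ; isWalk = isWalk ; inside = λ i → All.map (G⊆G′ _) (inside i) ; disjoint = disjoint }
    where open Walks P

  Walks-take : j ≤ k → Walks G w k → Walks G w j
  Walks-take j≤k P = record
    { walk     = walk ∘ inj
    ; isWalk   = isWalk ∘ inj
    ; inside   = inside ∘ inj
    ; disjoint = λ i i′ i≢i′ →
        disjoint (inj i) (inj i′) (i≢i′ ∘ inject≤-injective j≤k j≤k i i′)
    }
    where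
    open Walks P
    inj : Fin _ → Fin _
    inj i = inject≤ i j≤k

  Walks-cons : ∀ {S S′ es} → IsWalk D root es w → All (λ e → S e ≡ true) es →
    S′ ⊆ S → All (λ e → S′ e ≡ false) es → Walks S′ w k → Walks S w (suc k)
  Walks-cons {es = es} es-walk es⊆S S′⊆S es∉S′ P = record
    { walk     = walk′
    ; isWalk   = λ { zero → es-walk ; (suc i) → isWalk i }
    ; inside   = λ { zero → es⊆S ; (suc i) → All.map (S′⊆S _) (inside i) }
    ; disjoint = disjoint′
    }
    where
    open Walks P
    walk′ : Fin (suc _) → List (Fin m)
    walk′ zero    = es
    walk′ (suc i) = walk i
    apart : ∀ {e} i → e ∈ es → e ∉ walk i
    apart i e∈es e∈walk = not-¬ (All.lookup (inside i) e∈walk) (All.lookup es∉S′ e∈es)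
    disjoint′ : ∀ i j → i ≢ j → Disjoint (walk′ i) (walk′ j)
    disjoint′ zero    zero    0≢0 = ⊥-elim (0≢0 refl)
    disjoint′ zero    (suc j) _   (e∈es , e∈walk) = apart j e∈es e∈walk
    disjoint′ (suc i) zero    _   (e∈walk , e∈es) = apart i e∈es e∈walk
    disjoint′ (suc i) (suc j) i≢j = disjoint i j (i≢j ∘ cong suc)

  Walks-avoid : ∀ {f} (P : Walks G w k) → (∀ i → f ∉ Walks.walk P i) →
    (∀ e → G e ≡ true → e ≢ f → G′ e ≡ true) → Walks G′ w k
  Walks-avoid {f = f} P f∉ G-f⊆G′ = record
    { walk = walk ; isWalk = isWalk ; disjoint = disjoint
    ; inside   = λ i → All.tabulate λ {e} e∈ → G-f⊆G′ e (All.lookup (inside i) e∈) λ { refl → f∉ i e∈ }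
    }
    where open Walks P

  Separates : Vertex n → VertexSet → Set
  Separates w U = U w ≡ true × U root ≡ false

  cut : EdgeSet → VertexSet → ℕ
  cut G U = count (G ∩ enters U)

  walks≤cut-by : Walks G w k → (U : VertexSet) → Separates w U → (Q : EdgeSet) →
    (∀ e → G e ≡ true → enters U e ≡ true → (∃ λ fs → IsWalk D (head e) fs w) → Q e ≡ true) →
    k ≤ cut Q U
  walks≤cut-by P U (Uw , Uroot) Q covers =
    injective⇒≤count (Q ∩ enters U) crossing crossing-injective crossing∈
    where
    open Walks P
    crosses : ∀ i → ∃ λ e → e ∈ walk i × enters U e ≡ true
    crosses i = walk-enters U (isWalk i) Uroot Uw
    crossing : Fin _ → Fin m
    crossing i = proj₁ (crosses i)
    crossing-injective : ∀ {i i′} → crossing i ≡ crossing i′ → i ≡ i′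
    crossing-injective {i} {i′} same with i ≟ i′
    ... | yes i≡i′ = i≡i′
    ... | no i≢i′  = ⊥-elim (disjoint i i′ i≢i′
      (proj₁ (proj₂ (crosses i)) , subst (_∈ walk i′) (sym same) (proj₁ (proj₂ (crosses i′)))))
    crossing∈ : ∀ i → (Q ∩ enters U) (crossing i) ≡ true
    crossing∈ i with crosses i
    ... | e , e∈ , e-enters = cong₂ _∧_
      (covers e (All.lookup (inside i) e∈) e-enters (walk-from-head (isWalk i) e∈)) e-enters

  walks≤cut : Walks G w k → (U : VertexSet) → Separates w U → k ≤ cut G U
  walks≤cut {G = G} P U sep = walks≤cut-by P U sep G (λ _ Ge _ _ → Ge)

  cut-mono : G ⊆ G′ → ∀ U → cut G U ≤ cut G′ U
  cut-mono G⊆G′ U = count-mono (λ e → ∧-mono (G⊆G′ e))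
    where
    ∧-mono : ∀ {a a′ b} → (a ≡ true → a′ ≡ true) → a ∧ b ≡ true → a′ ∧ b ≡ true
    ∧-mono {true} a⇒a′ ab rewrite a⇒a′ refl = ab

  cut-drop : G′ ⊆ G → (U : VertexSet) (f : Fin m) →
    G′ f ≡ false → G f ≡ true → enters U f ≡ true → cut G′ U < cut G U
  cut-drop {G′ = G′} {G} G′⊆G U f G′f Gf f-enters =
    subst (cut G′ U <_) (sym (count-remove (G ∩ enters U) (cong₂ _∧_ Gf f-enters)))
      (s≤s (count-mono G′∩⊆))
    where
    G′∩⊆ : (G′ ∩ enters U) ⊆ ((G ∩ enters U) - f)
    G′∩⊆ e G′∩e with e ≟ f | G′ e in G′e
    ... | yes refl | true  with () ← trans (sym G′f) G′e
    ... | no _     | true  rewrite G′⊆G e G′e = trans (∧-identityʳ _) G′∩e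

  cut-submodular : ∀ G U W → cut G (U ∩ W) + cut G (U ∪ W) ≤ cut G U + cut G W
  cut-submodular G U W = subst₂ _≤_
    (∑-distrib-+ (bit ∘ (G ∩ enters (U ∩ W))) (bit ∘ (G ∩ enters (U ∪ W))))
    (∑-distrib-+ (bit ∘ (G ∩ enters U)) (bit ∘ (G ∩ enters W)))
    (sum-mono (λ e → pointwise (G e) (U (tail e)) (W (tail e)) (U (head e)) (W (head e))))
    where
    pointwise : ∀ g ut wt uh wh →
      bit (g ∧ (not (ut ∧ wt) ∧ (uh ∧ wh))) + bit (g ∧ (not (ut ∨ wt) ∧ (uh ∨ wh)))
        ≤ bit (g ∧ (not ut ∧ uh)) + bit (g ∧ (not wt ∧ wh))
    pointwise false _     _     _     _     = z≤n
    pointwise true  true  true  _     _     = z≤n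
    pointwise true  true  false true  true  = s≤s z≤n
    pointwise true  true  false true  false = z≤n
    pointwise true  true  false false true  = z≤n
    pointwise true  true  false false false = z≤n
    pointwise true  false true  true  true  = s≤s z≤n
    pointwise true  false true  true  false = z≤n
    pointwise true  false true  false true  = z≤n
    pointwise true  false true  false false = z≤n
    pointwise true  false false true  true  = s≤s (s≤s z≤n)
    pointwise true  false false true  false = s≤s z≤n
    pointwise true  false false false true  = s≤s z≤n
    pointwise true  false false false false = z≤n

  -- Flows, residual walks and max-flow min-cut

  inDeg outDeg : EdgeSet → Vertex n → ℕ
  inDeg  S x = count (S ∩ λ e → head e == x)
  outDeg S x = count (S ∩ λ e → tail e == x)

  record IsFlow (w : Vertex n) (S : EdgeSet) : Set where
    field
      conserved : ∀ x → x ≢ root → x ≢ w → inDeg S x ≡ outDeg S x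
      sink      : outDeg S w ≡ 0

  leaves within : VertexSet → Fin m → Bool
  leaves U e = U (tail e) ∧ not (U (head e))
  within U e = U (tail e) ∧ U (head e)

  count-head∈ : ∀ S U → count (S ∩ (U ∘ head)) ≡ count (S ∩ within U) + count (S ∩ enters U)
  count-head∈ S U = trans (sum-cong-≗ (λ e → split (S e) (U (tail e)) (U (head e))))
    (∑-distrib-+ (bit ∘ (S ∩ within U)) (bit ∘ (S ∩ enters U)))
    where
    split : ∀ s t h → bit (s ∧ h) ≡ bit (s ∧ (t ∧ h)) + bit (s ∧ (not t ∧ h))
    split false _     _     = refl
    split true  true  true  = refl
    split true  true  false = refl
    split true  false true  = refl
    split true  false false = refl

  count-tail∈ : ∀ S U → count (S ∩ (U ∘ tail)) ≡ count (S ∩ within U) + count (S ∩ leaves U)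
  count-tail∈ S U = trans (sum-cong-≗ (λ e → split (S e) (U (tail e)) (U (head e))))
    (∑-distrib-+ (bit ∘ (S ∩ within U)) (bit ∘ (S ∩ leaves U)))
    where
    split : ∀ s t h → bit (s ∧ t) ≡ bit (s ∧ (t ∧ h)) + bit (s ∧ (t ∧ not h))
    split false _     _     = refl
    split true  true  true  = refl
    split true  true  false = refl
    split true  false true  = refl
    split true  false false = refl

  ∑-inDeg≡∑-outDeg+value : {S : EdgeSet} → IsFlow w S → Separates w U →
    sum (λ x → if U x then inDeg S x else 0) ≡ sum (λ x → if U x then outDeg S x else 0) + inDeg S w
  ∑-inDeg≡∑-outDeg+value {w = w} {U = U} {S} flow (Uw , Uroot) = begin
    sum (λ x → if U x then inDeg S x else 0)
      ≡⟨ sum-cong-≗ (λ x → conservation x (x ≟ w)) ⟩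
    sum (λ x → (if U x then outDeg S x else 0) + (if x == w then inDeg S w else 0))
      ≡⟨ ∑-distrib-+ (λ x → if U x then outDeg S x else 0) (λ x → if x == w then inDeg S w else 0) ⟩
    sum (λ x → if U x then outDeg S x else 0) + sum (λ x → if x == w then inDeg S w else 0)
      ≡⟨ cong (sum (λ x → if U x then outDeg S x else 0) +_) (sum-point w (inDeg S w)) ⟩
    sum (λ x → if U x then outDeg S x else 0) + inDeg S w
      ∎
    where
    open ≡-Reasoning
    open IsFlow flow
    conservation : ∀ x → Dec (x ≡ w) →
      (if U x then inDeg S x else 0) ≡ (if U x then outDeg S x else 0) + (if x == w then inDeg S w else 0)
    conservation x (yes refl) rewrite ==-refl x | Uw | sink = refl
    conservation x (no x≢w) rewrite ≢⇒==-false x≢w with U x in Ux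
    ... | true  = trans (conserved x x≢root x≢w) (sym (+-identityʳ _))
      where
      x≢root : x ≢ root
      x≢root refl with () ← trans (sym Ux) Uroot
    ... | false = refl

  flow-across-cut : {S : EdgeSet} → IsFlow w S → Separates w U →
    count (S ∩ enters U) ≡ inDeg S w + count (S ∩ leaves U)
  flow-across-cut {w = w} {U = U} {S} flow sep = +-cancelˡ-≡ (count (S ∩ within U)) _ _ (begin
    count (S ∩ within U) + count (S ∩ enters U)              ≡⟨ count-head∈ S U ⟨
    count (S ∩ (U ∘ head))                                   ≡⟨ ∑-count-fibres S head U ⟨
    sum (λ x → if U x then inDeg S x else 0)                 ≡⟨ ∑-inDeg≡∑-outDeg+value {U = U} flow sep ⟩
    sum (λ x → if U x then outDeg S x else 0) + inDeg S w    ≡⟨ cong (_+ inDeg S w) (∑-count-fibres S tail U) ⟩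
    count (S ∩ (U ∘ tail)) + inDeg S w                       ≡⟨ cong (_+ inDeg S w) (count-tail∈ S U) ⟩
    count (S ∩ within U) + count (S ∩ leaves U) + inDeg S w  ≡⟨ rearrange _ (count (S ∩ leaves U)) (inDeg S w) ⟩
    count (S ∩ within U) + (inDeg S w + count (S ∩ leaves U)) ∎)
    where
    open ≡-Reasoning
    rearrange : ∀ a b c → a + b + c ≡ a + (c + b)
    rearrange = solve-∀

  data Step : Set where
    fwd bwd : Fin m → Step

  edge : Step → Fin m
  edge (fwd e) = e
  edge (bwd e) = e

  src tgt : Step → Vertex n
  src (fwd e) = tail e
  src (bwd e) = head e
  tgt (fwd e) = head e
  tgt (bwd e) = tail e

  -- The steps of a residual walk are listed from the last one back to the first.
  data ResidualWalk (a : Vertex n) : List Step → Vertex n → Set where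
    []   : ResidualWalk a [] a
    snoc : ∀ {ss b s} → ResidualWalk a ss b → src s ≡ b → ResidualWalk a (s ∷ ss) (tgt s)

  residual : EdgeSet → EdgeSet → Step → Bool
  residual G S (fwd e) = G e ∧ not (S e)
  residual G S (bwd e) = S e

  apply : EdgeSet → Step → EdgeSet
  apply S (fwd e) = S ∪⁅ e ⁆
  apply S (bwd e) = S - e

  applyAll : EdgeSet → List Step → EdgeSet
  applyAll S []       = S
  applyAll S (s ∷ ss) = apply (applyAll S ss) s

  apply-elsewhere : ∀ S s {e} → edge s ≢ e → apply S s e ≡ S e
  apply-elsewhere S (fwd f) {e} f≢e rewrite ≢⇒==-false (f≢e ∘ sym) = ∨-identityʳ (S e)
  apply-elsewhere S (bwd f) {e} f≢e rewrite ≢⇒==-false (f≢e ∘ sym) = ∧-identityʳ (S e)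

  applyAll-elsewhere : ∀ S ss {e} → All (e ≢_) (map edge ss) → applyAll S ss e ≡ S e
  applyAll-elsewhere S []       _              = refl
  applyAll-elsewhere S (s ∷ ss) (e≢s ∷ e≢ss) =
    trans (apply-elsewhere (applyAll S ss) s (e≢s ∘ sym)) (applyAll-elsewhere S ss e≢ss)

  residual-local : ∀ G {S S′} s → S (edge s) ≡ S′ (edge s) → residual G S s ≡ residual G S′ s
  residual-local G (fwd e) same = cong (λ b → G e ∧ not b) same
  residual-local G (bwd e) same = same

  apply-⊆ : ∀ {G S} s → residual G S s ≡ true → S ⊆ G → apply S s ⊆ G
  apply-⊆ {G} {S} (fwd f) ok S⊆G e e∈ with e ≟ f
  ... | yes refl = ∧-conicalˡ (G e) _ ok
  ... | no _     = S⊆G e (trans (sym (∨-identityʳ (S e))) e∈)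
  apply-⊆ {G} {S} (bwd f) ok S⊆G e e∈ = S⊆G e (∧-conicalˡ (S e) _ e∈)

  applyAll-⊆ : ∀ {G S} ss → All (λ s → residual G S s ≡ true) ss → Unique (map edge ss) →
    S ⊆ G → applyAll S ss ⊆ G
  applyAll-⊆ []       _          _           S⊆G = S⊆G
  applyAll-⊆ {G} {S} (s ∷ ss) (ok ∷ oks) (fresh ∷ u) S⊆G =
    apply-⊆ s (trans (residual-local G s (applyAll-elsewhere S ss fresh)) ok) (applyAll-⊆ ss oks u S⊆G)

  -- S′ carries one more unit of a-b flow than S: in − out grows by 1 at b and drops by 1 at a
  -- (written without subtraction).
  AddsUnit : EdgeSet → EdgeSet → Vertex n → Vertex n → Set
  AddsUnit S S′ a b = ∀ x → inDeg S′ x + outDeg S x + bit (a == x) ≡ inDeg S x + outDeg S′ x + bit (b == x)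

  AddsUnit-trans : ∀ {S S₁ S₂} → AddsUnit S S₁ a b → AddsUnit S₁ S₂ b c → AddsUnit S S₂ a c
  AddsUnit-trans {a} {b} {c} {S} {S₁} {S₂} p q x = +-cancelʳ-≡ (i₁ + o₁ + β) _ _ (begin
    (i₂ + o₀ + α) + (i₁ + o₁ + β)  ≡⟨ regroup i₂ o₀ α i₁ o₁ β ⟩
    (i₁ + o₀ + α) + (i₂ + o₁ + β)  ≡⟨ cong₂ _+_ (p x) (q x) ⟩
    (i₀ + o₁ + β) + (i₁ + o₂ + γ)  ≡⟨ regroup′ i₀ o₁ β i₁ o₂ γ ⟩
    (i₀ + o₂ + γ) + (i₁ + o₁ + β)  ∎)
    where
    open ≡-Reasoning
    i₀ i₁ i₂ o₀ o₁ o₂ α β γ : ℕ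
    i₀ = inDeg S x
    i₁ = inDeg S₁ x
    i₂ = inDeg S₂ x
    o₀ = outDeg S x
    o₁ = outDeg S₁ x
    o₂ = outDeg S₂ x
    α = bit (a == x)
    β = bit (b == x)
    γ = bit (c == x)
    regroup : ∀ a b c d e f → a + b + c + (d + e + f) ≡ d + b + c + (a + e + f)
    regroup = solve-∀
    regroup′ : ∀ a b c d e f → a + b + c + (d + e + f) ≡ a + e + f + (d + b + c)
    regroup′ = solve-∀

  AddsUnit-conserved : ∀ {S S′ x} → AddsUnit S S′ a b → x ≢ a → x ≢ b →
    inDeg S x ≡ outDeg S x → inDeg S′ x ≡ outDeg S′ x
  AddsUnit-conserved {a} {b} {S} {S′} {x} balance x≢a x≢b conserved = +-cancelʳ-≡ (outDeg S x) _ _ (begin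
    inDeg S′ x + outDeg S x                 ≡⟨ +-identityʳ _ ⟨
    inDeg S′ x + outDeg S x + 0             ≡⟨ cong (λ c → inDeg S′ x + outDeg S x + bit c) (c≢x⇒false x≢a) ⟨
    inDeg S′ x + outDeg S x + bit (a == x)  ≡⟨ balance x ⟩
    inDeg S x + outDeg S′ x + bit (b == x)
      ≡⟨ cong₂ (λ i c → i + outDeg S′ x + bit c) conserved (c≢x⇒false x≢b) ⟩
    outDeg S x + outDeg S′ x + 0            ≡⟨ drop-zero (outDeg S x) (outDeg S′ x) ⟩
    outDeg S′ x + outDeg S x                ∎)
    where
    open ≡-Reasoning
    drop-zero : ∀ i j → i + j + 0 ≡ j + i
    drop-zero = solve-∀
    c≢x⇒false : ∀ {c} → x ≢ c → (c == x) ≡ false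
    c≢x⇒false x≢c = ≢⇒==-false (x≢c ∘ sym)

  AddsUnit-at-sink : ∀ {S S′ x} → AddsUnit S S′ a b → outDeg S x ≡ 0 → outDeg S′ x ≡ 0 →
    inDeg S′ x + bit (a == x) ≡ inDeg S x + bit (b == x)
  AddsUnit-at-sink {a} {b} {S} {S′} {x} balance no-out no-out′ = begin
    inDeg S′ x + bit (a == x)               ≡⟨ cong (_+ bit (a == x)) (+-identityʳ _) ⟨
    inDeg S′ x + 0 + bit (a == x)           ≡⟨ cong (λ o → inDeg S′ x + o + bit (a == x)) no-out ⟨
    inDeg S′ x + outDeg S x + bit (a == x)  ≡⟨ balance x ⟩
    inDeg S x + outDeg S′ x + bit (b == x)  ≡⟨ cong (λ o → inDeg S x + o + bit (b == x)) no-out′ ⟩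
    inDeg S x + 0 + bit (b == x)            ≡⟨ cong (_+ bit (b == x)) (+-identityʳ _) ⟩
    inDeg S x + bit (b == x)                ∎
    where open ≡-Reasoning

  apply-balance : ∀ G S s → residual G S s ≡ true → AddsUnit S (apply S s) (src s) (tgt s)
  apply-balance G S (fwd e) ok x
    rewrite count-∩-insert S (λ e → head e == x) (not-injective (∧-conicalʳ (G e) _ ok))
          | count-∩-insert S (λ e → tail e == x) (not-injective (∧-conicalʳ (G e) _ ok)) =
      rearrange (bit (head e == x)) (inDeg S x) (outDeg S x) (bit (tail e == x))
    where
    rearrange : ∀ a b c d → a + b + c + d ≡ b + (d + c) + a
    rearrange = solve-∀
  apply-balance G S (bwd e) ok x
    rewrite count-∩-remove S (λ e → head e == x) ok | count-∩-remove S (λ e → tail e == x) ok =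
      rearrange (inDeg (S - e) x) (bit (tail e == x)) (outDeg (S - e) x) (bit (head e == x))
    where
    rearrange : ∀ a b c d → a + (b + c) + d ≡ d + a + c + b
    rearrange = solve-∀

  applyAll-balance : ∀ G S {a b ss} → ResidualWalk a ss b → All (λ s → residual G S s ≡ true) ss →
    Unique (map edge ss) → AddsUnit S (applyAll S ss) a b
  applyAll-balance G S []                                _          _           x = refl
  applyAll-balance G S (snoc {ss = ss} {s = s} p refl) (ok ∷ oks) (fresh ∷ u) =
    AddsUnit-trans (applyAll-balance G S p oks u) (apply-balance G (applyAll S ss) s ok′)
    where
    ok′ : residual G (applyAll S ss) s ≡ true
    ok′ = trans (residual-local G s (applyAll-elsewhere S ss fresh)) ok

  apply-outDeg≤ : ∀ S s {x} → src s ≢ x → outDeg (apply S s) x ≤ outDeg S x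
  apply-outDeg≤ S (fwd f) {x} tailf≢x = count-mono kept
    where
    kept : (apply S (fwd f) ∩ λ e → tail e == x) ⊆ (S ∩ λ e → tail e == x)
    kept e e∈ with e ≟ f
    ... | yes refl with () ← trans (sym (≢⇒==-false tailf≢x)) (∧-conicalʳ _ _ e∈)
    ... | no _ rewrite ∨-identityʳ (S e) = e∈
  apply-outDeg≤ S (bwd f) {x} _ = count-mono kept
    where
    kept : (apply S (bwd f) ∩ λ e → tail e == x) ⊆ (S ∩ λ e → tail e == x)
    kept e e∈ = cong₂ _∧_ (∧-conicalˡ (S e) _ (∧-conicalˡ _ _ e∈)) (∧-conicalʳ _ _ e∈)

  applyAll-outDeg≤ : ∀ S ss {x} → All (λ s → src s ≢ x) ss → outDeg (applyAll S ss) x ≤ outDeg S x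
  applyAll-outDeg≤ S []       _              = ≤-refl
  applyAll-outDeg≤ S (s ∷ ss) (s≢x ∷ ss≢x) =
    ≤-trans (apply-outDeg≤ (applyAll S ss) s s≢x) (applyAll-outDeg≤ S ss ss≢x)

  record ResidualPath (G S : EdgeSet) (w x : Vertex n) : Set where
    field
      steps          : List Step
      isWalk         : ResidualWalk root steps x
      residual-steps : All (λ s → residual G S s ≡ true) steps
      fresh          : Unique (map edge steps)
      avoids         : All (λ s → src s ≢ w) steps

  augment : ∀ {G S} → w ≢ root → S ⊆ G → IsFlow w S → ResidualPath G S w w →
    Σ EdgeSet λ S′ → S′ ⊆ G × IsFlow w S′ × inDeg S′ w ≡ suc (inDeg S w)
  augment {w} {G} {S} w≢root S⊆G flow P =
    S′ , applyAll-⊆ steps residual-steps fresh S⊆G ,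
    record { conserved = conserved′ ; sink = sink′ } , value′
    where
    open ResidualPath P
    open IsFlow flow
    S′ : EdgeSet
    S′ = applyAll S steps
    balance : AddsUnit S S′ root w
    balance = applyAll-balance G S isWalk residual-steps fresh
    sink′ : outDeg S′ w ≡ 0
    sink′ = n≤0⇒n≡0 (subst (outDeg S′ w ≤_) sink (applyAll-outDeg≤ S steps avoids))
    conserved′ : ∀ x → x ≢ root → x ≢ w → inDeg S′ x ≡ outDeg S′ x
    conserved′ x x≢root x≢w = AddsUnit-conserved balance x≢root x≢w (conserved x x≢root x≢w)
    value′ : inDeg S′ w ≡ suc (inDeg S w)
    value′ = begin
      inDeg S′ w                   ≡⟨ +-identityʳ _ ⟨
      inDeg S′ w + 0               ≡⟨ cong (λ b → inDeg S′ w + bit b) (≢⇒==-false (w≢root ∘ sym)) ⟨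
      inDeg S′ w + bit (root == w) ≡⟨ AddsUnit-at-sink balance sink sink′ ⟩
      inDeg S w + bit (w == w)     ≡⟨ cong (λ b → inDeg S w + bit b) (==-refl w) ⟩
      inDeg S w + 1                ≡⟨ +-comm (inDeg S w) 1 ⟩
      suc (inDeg S w)              ∎
      where open ≡-Reasoning

  record ResidualCut (G S : EdgeSet) (w : Vertex n) : Set where
    field
      reach  : VertexSet
      root∈  : reach root ≡ true
      w∉     : reach w ≡ false
      closed : ∀ s → residual G S s ≡ true → reach (src s) ≡ true → reach (tgt s) ≡ true

  shared-edge : ∀ s s′ → edge s ≡ edge s′ → tgt s ≡ src s′ ⊎ tgt s ≡ tgt s′
  shared-edge (fwd e) (fwd .e) refl = inj₂ refl
  shared-edge (fwd e) (bwd .e) refl = inj₁ refl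
  shared-edge (bwd e) (fwd .e) refl = inj₁ refl
  shared-edge (bwd e) (bwd .e) refl = inj₂ refl

  module Exploration (G S : EdgeSet) (w : Vertex n) where

    Inside : VertexSet → Step → Set
    Inside R s = R (src s) ≡ true × R (tgt s) ≡ true

    Reached : VertexSet → Vertex n → Set
    Reached R x = Σ (ResidualPath G S w x) λ P → All (Inside R) (ResidualPath.steps P)

    frontier : VertexSet → Step → Bool
    frontier R s = residual G S s ∧ (R (src s) ∧ not (R (tgt s)))

    find-frontier : ∀ R → (∃ λ s → frontier R s ≡ true) ⊎ (∀ s → frontier R s ≡ false)
    find-frontier R
      with any? (λ e → frontier R (fwd e) Data.Bool.≟ true) | any? (λ e → frontier R (bwd e) Data.Bool.≟ true)
    ... | yes (e , e-frontier) | _                    = inj₁ (fwd e , e-frontier)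
    ... | no _                 | yes (e , e-frontier) = inj₁ (bwd e , e-frontier)
    ... | no no-fwd            | no no-bwd            = inj₂ λ
      { (fwd e) → ¬-not (no-fwd ∘ (e ,_))
      ; (bwd e) → ¬-not (no-bwd ∘ (e ,_))
      }

    closed-without-frontier : ∀ R → (∀ s → frontier R s ≡ false) →
      ∀ s → residual G S s ≡ true → R (src s) ≡ true → R (tgt s) ≡ true
    closed-without-frontier R none s ok Rsrc with R (tgt s) in Rtgt
    ... | true  = refl
    ... | false = ⊥-elim (not-¬ s-frontier (none s))
      where
      s-frontier : frontier R s ≡ true
      s-frontier rewrite ok | Rsrc | Rtgt = refl

    Reached-mono : ∀ {R R′ x} → R ⊆ R′ → Reached R x → Reached R′ x
    Reached-mono R⊆R′ (P , inside) = P , All.map (λ (a , b) → R⊆R′ _ a , R⊆R′ _ b) inside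

    extend : ∀ R → R w ≡ false → (∀ x → R x ≡ true → Reached R x) → ∀ s → frontier R s ≡ true →
      ∀ x → (R ∪⁅ tgt s ⁆) x ≡ true → Reached (R ∪⁅ tgt s ⁆) x
    extend R Rw reached s s-frontier x x∈ with x ≟ tgt s
    ... | no _ = Reached-mono R⊆R′ (reached x (trans (sym (∨-identityʳ (R x))) x∈))
      where
      R⊆R′ : R ⊆ (R ∪⁅ tgt s ⁆)
      R⊆R′ y Ry rewrite Ry = refl
    ... | yes refl = record
      { steps          = s ∷ steps
      ; isWalk         = snoc isWalk refl
      ; residual-steps = ok ∷ residual-steps
      ; fresh          = All.map⁺ {f = edge} (All.map (λ {s′} → new-edge {s′}) inside) ∷ fresh
      ; avoids         = src≢w ∷ avoids
      }
      , (R⊆R′ _ Rsrc , ∨-zeroʳ′) ∷ All.map (λ (a , b) → R⊆R′ _ a , R⊆R′ _ b) inside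
      where
      ok : residual G S s ≡ true
      ok = ∧-conicalˡ (residual G S s) _ s-frontier
      Rsrc : R (src s) ≡ true
      Rsrc = ∧-conicalˡ (R (src s)) _ (∧-conicalʳ (residual G S s) _ s-frontier)
      Rtgt : R (tgt s) ≡ false
      Rtgt = not-injective (∧-conicalʳ (R (src s)) _ (∧-conicalʳ (residual G S s) _ s-frontier))
      open ResidualPath (proj₁ (reached (src s) Rsrc))
      inside : All (Inside R) steps
      inside = proj₂ (reached (src s) Rsrc)
      R⊆R′ : R ⊆ (R ∪⁅ tgt s ⁆)
      R⊆R′ y Ry rewrite Ry = refl
      ∨-zeroʳ′ : (R ∪⁅ tgt s ⁆) (tgt s) ≡ true
      ∨-zeroʳ′ rewrite ==-refl (tgt s) = ∨-zeroʳ (R (tgt s))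
      src≢w : src s ≢ w
      src≢w src≡w with () ← trans (sym Rsrc) (trans (cong R src≡w) Rw)
      new-edge : ∀ {s′} → Inside R s′ → edge s ≢ edge s′
      new-edge {s′} (Rsrc′ , Rtgt′) same with shared-edge s s′ same
      ... | inj₁ tgt≡src′ with () ← trans (sym Rtgt) (trans (cong R tgt≡src′) Rsrc′)
      ... | inj₂ tgt≡tgt′ with () ← trans (sym Rtgt) (trans (cong R tgt≡tgt′) Rtgt′)

    explore : (fuel : ℕ) (R : VertexSet) → R root ≡ true → (∀ x → R x ≡ true → Reached R x) →
      suc (suc n) ≤ fuel + count R → ResidualPath G S w w ⊎ ResidualCut G S w
    explore zero       R _     _       bound = ⊥-elim (<-irrefl refl (≤-trans bound (count≤ R)))
    explore (suc fuel) R root∈ reached bound with R w in Rw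
    ... | true  = inj₁ (proj₁ (reached w Rw))
    ... | false with find-frontier R
    ...   | inj₂ none =
      inj₂ (record { reach = R ; root∈ = root∈ ; w∉ = Rw ; closed = closed-without-frontier R none })
    ...   | inj₁ (s , s-frontier) =
      explore fuel (R ∪⁅ tgt s ⁆) (cong (_∨ (root == tgt s)) root∈) (extend R Rw reached s s-frontier) bound′
      where
      tgt∉R : R (tgt s) ≡ false
      tgt∉R = not-injective (∧-conicalʳ (R (src s)) _ (∧-conicalʳ (residual G S s) _ s-frontier))
      bound′ : suc (suc n) ≤ fuel + count (R ∪⁅ tgt s ⁆)
      bound′ rewrite count-insert R tgt∉R | +-suc fuel (count R) = bound

    find-residual-path : ResidualPath G S w w ⊎ ResidualCut G S w
    find-residual-path = explore (suc n) R₀ (==-refl (root {n})) reached-root bound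
      where
      R₀ : VertexSet
      R₀ = _== root
      reached-root : ∀ x → R₀ x ≡ true → Reached R₀ x
      reached-root x x≡root with ==⇒≡ x≡root
      ... | refl = record { steps = [] ; isWalk = [] ; residual-steps = [] ; fresh = [] ; avoids = [] } , []
      bound : suc (suc n) ≤ suc n + count R₀
      bound = subst (λ c → suc (suc n) ≤ suc n + c) (sym (count-singleton (root {n})))
        (≤-reflexive (cong suc (+-comm 1 n)))

  residual-cut≤value : ∀ {G S w} → IsFlow w S → (C : ResidualCut G S w) →
    cut G (not ∘ ResidualCut.reach C) ≤ inDeg S w
  residual-cut≤value {G} {S} {w} flow C = begin
    cut G unreached                           ≤⟨ count-mono G-entering⊆S ⟩
    count (S ∩ enters unreached)              ≡⟨ flow-across-cut {U = unreached} flow separates ⟩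
    inDeg S w + count (S ∩ leaves unreached)  ≡⟨ cong (inDeg S w +_) (count-empty _ none-leaving) ⟩
    inDeg S w + 0                             ≡⟨ +-identityʳ _ ⟩
    inDeg S w                                 ∎
    where
    open ResidualCut C
    open ≤-Reasoning
    unreached : VertexSet
    unreached = not ∘ reach
    separates : Separates w unreached
    separates = cong not w∉ , cong not root∈
    entering-in-S : ∀ e → (G ∩ enters unreached) e ≡ true → S e ≡ true
    entering-in-S e e∈ with S e in Se
    ... | true  = refl
    ... | false = ⊥-elim (not-¬ (closed (fwd e) fwd-residual reach-tail) reach-head)
      where
      e-enters : enters unreached e ≡ true
      e-enters = ∧-conicalʳ (G e) _ e∈
      fwd-residual : residual G S (fwd e) ≡ true
      fwd-residual rewrite Se = trans (∧-identityʳ (G e)) (∧-conicalˡ (G e) _ e∈)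
      reach-tail : reach (tail e) ≡ true
      reach-tail = trans (sym (not-involutive _)) (∧-conicalˡ (not (not (reach (tail e)))) _ e-enters)
      reach-head : reach (head e) ≡ false
      reach-head = not-injective (∧-conicalʳ (not (not (reach (tail e)))) _ e-enters)
    G-entering⊆S : (G ∩ enters unreached) ⊆ (S ∩ enters unreached)
    G-entering⊆S e e∈ = cong₂ _∧_ (entering-in-S e e∈) (∧-conicalʳ (G e) _ e∈)
    none-leaving : ∀ e → (S ∩ leaves unreached) e ≡ false
    none-leaving e = ¬-not leaving-impossible
      where
      leaving-impossible : (S ∩ leaves unreached) e ≢ true
      leaving-impossible e∈ = not-¬ (closed (bwd e) (∧-conicalˡ (S e) _ e∈) reach-head) reach-tail
        where
        e-leaves : leaves unreached e ≡ true
        e-leaves = ∧-conicalʳ (S e) _ e∈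
        reach-head : reach (head e) ≡ true
        reach-head = trans (sym (not-involutive _)) (∧-conicalʳ (not (reach (tail e))) _ e-leaves)
        reach-tail : reach (tail e) ≡ false
        reach-tail = not-injective (∧-conicalˡ (not (reach (tail e))) _ e-leaves)

  record MaxFlow (G : EdgeSet) (w : Vertex n) : Set where
    field
      flow      : EdgeSet
      flow⊆G    : flow ⊆ G
      isFlow    : IsFlow w flow
      cutSet    : VertexSet
      separates : Separates w cutSet
      cut≤value : cut G cutSet ≤ inDeg flow w

  augment-until-cut : ∀ {G} → w ≢ root → (fuel : ℕ) (S : EdgeSet) → S ⊆ G → IsFlow w S →
    suc m ≤ fuel + inDeg S w → MaxFlow G w
  augment-until-cut {w} w≢root zero S _ _ bound =
    ⊥-elim (<-irrefl refl (≤-trans bound (count≤ (S ∩ λ e → head e == w))))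
  augment-until-cut {w} {G} w≢root (suc fuel) S S⊆G flow bound with Exploration.find-residual-path G S w
  ... | inj₁ P =
    let S′ , S′⊆G , flow′ , value′ = augment w≢root S⊆G flow P
    in augment-until-cut w≢root fuel S′ S′⊆G flow′
         (subst (suc m ≤_) (trans (sym (+-suc fuel _)) (cong (fuel +_) (sym value′))) bound)
  ... | inj₂ C = record
    { flow = S ; flow⊆G = S⊆G ; isFlow = flow
    ; cutSet = not ∘ reach ; separates = cong not w∉ , cong not root∈ ; cut≤value = residual-cut≤value flow C
    }
    where open ResidualCut C

  max-flow-min-cut : ∀ G w → w ≢ root → MaxFlow G w
  max-flow-min-cut G w w≢root =
    augment-until-cut w≢root (suc m) (λ _ → false) (λ _ ()) empty (m≤m+n (suc m) _)
    where
    empty : IsFlow w (λ _ → false)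
    empty = record { conserved = λ _ _ _ → refl ; sink = count-∅ {m} }

  bwd-walk : IsWalk D x es w → ResidualWalk w (map bwd es) x
  bwd-walk nil           = []
  bwd-walk (cons refl p) = snoc (bwd-walk p) refl

  edges-bwd : ∀ es → map edge (map bwd es) ≡ es
  edges-bwd []       = refl
  edges-bwd (e ∷ es) = cong (e ∷_) (edges-bwd es)

  -- Deleting the edges of a walk is pushing one unit of flow back along it, so applyAll-balance applies.
  _∖_ : EdgeSet → List (Fin m) → EdgeSet
  S ∖ es = applyAll S (map bwd es)

  ∖-⊆ : ∀ S es → (S ∖ es) ⊆ S
  ∖-⊆ S []       = λ _ e∈ → e∈
  ∖-⊆ S (f ∷ es) e e∈ = ∖-⊆ S es e (p-x⊆p (S ∖ es) f e e∈)

  ∖-removes : ∀ S es → All (λ e → (S ∖ es) e ≡ false) es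
  ∖-removes S []       = []
  ∖-removes S (f ∷ es) = removed ∷ All.map (λ {e} e∉ → cong (_∧ not (e == f)) e∉) (∖-removes S es)
    where
    removed : ((S ∖ es) - f) f ≡ false
    removed = x∉p-x (S ∖ es) f

  allEdges : EdgeSet
  allEdges _ = true

  restrictInto : EdgeSet → Vertex n → EdgeSet → EdgeSet
  restrictInto G v X e = G e ∧ (not (head e == v) ∨ X e)

  -- For X ⊆ in_D(v), Linked allEdges v X is independence of X in 𝒢_D(v) (IndepG⇒Linked, Linked⇒IndepG).
  Linked : EdgeSet → Vertex n → EdgeSet → Set
  Linked G v X = Walks (restrictInto G v X) v (count X)

  restrictInto-at-v : ∀ G v X {e} → restrictInto G v X e ≡ true → head e ≡ v → X e ≡ true
  restrictInto-at-v G _ X {e} e∈ refl with G e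
  ... | true rewrite ==-refl (head e) = e∈

  Linked-cong : ∀ {X X′} → X ≗ X′ → Linked G v X → Linked G v X′
  Linked-cong {G = G} {v = v} X≗X′ linked = subst (Walks _ v) (count-cong X≗X′)
    (Walks-mono (λ e → subst (λ b → G e ∧ (not (head e == v) ∨ b) ≡ true) (X≗X′ e)) linked)

  restrictInto⊆ : restrictInto G v X ⊆ G
  restrictInto⊆ {G = G} e e∈ = ∧-conicalˡ (G e) _ e∈

  restrictInto-monoˡ : G ⊆ G′ → restrictInto G v X ⊆ restrictInto G′ v X
  restrictInto-monoˡ {G = G} G⊆G′ e e∈ =
    cong₂ _∧_ (G⊆G′ e (∧-conicalˡ (G e) _ e∈)) (∧-conicalʳ (G e) _ e∈)

  restrictInto-mono : ∀ {X X′} → X ⊆ X′ → restrictInto G v X ⊆ restrictInto G v X′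
  restrictInto-mono {G = G} {v = v} {X} {X′} X⊆X′ e e∈ with G e | head e == v | X e in Xe | X′ e in X′e
  ... | false | _     | _     | _     = e∈
  ... | true  | false | _     | _     = refl
  ... | true  | true  | _     | true  = refl
  ... | true  | true  | true  | false with () ← trans (sym X′e) (X⊆X′ e Xe)
  ... | true  | true  | false | false = e∈

  restrictInto-delete : ∀ H v X {f e} → restrictInto H v X e ≡ true → e ≢ f →
    restrictInto (H - f) v X e ≡ true
  restrictInto-delete H v X {f} {e} e∈ e≢f rewrite ≢⇒==-false e≢f | ∧-identityʳ (H e) = e∈

  -- Menger's theorem and maximal linked sets in acyclic digraphs

  module _ (acyclic : Acyclic D) where

    inflow-at-walk-start : ∀ {S} → IsFlow w S → 0 < inDeg S w → x ≢ root → IsWalk D x es w →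
      All (λ e → S e ≡ true) es → 0 < inDeg S x
    inflow-at-walk-start         flow value>0 _      nil                     _          = value>0
    inflow-at-walk-start {w = w} {S = S} flow value>0 x≢root (cons {e = e} refl _) (Se ∷ _) with tail e ≟ w
    ... | yes refl = value>0
    ... | no x≢w   = subst (0 <_) (sym (IsFlow.conserved flow (tail e) x≢root x≢w))
                       (count-pos (S ∩ λ f → tail f == tail e) (cong₂ _∧_ Se (==-refl (tail e))))

    positive-flow⇒walk : ∀ {S} → IsFlow w S → 0 < inDeg S w →
      ∃ λ es → IsWalk D root es w × All (λ e → S e ≡ true) es
    positive-flow⇒walk {w = w} {S = S} flow value>0 = extend-back (suc n) nil [] (≤-reflexive (sym (+-identityʳ _)))
      where
      extend-back : ∀ (fuel : ℕ) {x es} → IsWalk D x es w → All (λ e → S e ≡ true) es →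
        suc n ≤ fuel + length es → ∃ λ es → IsWalk D root es w × All (λ e → S e ≡ true) es
      extend-back fuel {x} p p⊆S bound with x ≟ root
      ... | yes refl = _ , p , p⊆S
      extend-back zero       p _ bound | no _ =
        ⊥-elim (<-irrefl refl (≤-trans bound (acyclic⇒length≤ acyclic p)))
      extend-back (suc fuel) {x} {es} p p⊆S bound | no x≢root
        with count-witness (S ∩ λ e → head e == x) (inflow-at-walk-start flow value>0 x≢root p p⊆S)
      ... | e , e∈ = extend-back fuel (cons refl (subst (λ v → IsWalk D v es w) (sym he≡x) p))
                       (∧-conicalˡ (S e) _ e∈ ∷ p⊆S) (subst (suc n ≤_) (sym (+-suc fuel (length es))) bound)
        where
        he≡x : head e ≡ x
        he≡x = ==⇒≡ (∧-conicalʳ (S e) _ e∈)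

    remove-path : ∀ {S ps} → w ≢ root → IsFlow w S → IsWalk D root ps w → All (λ e → S e ≡ true) ps →
      IsFlow w (S ∖ ps) × suc (inDeg (S ∖ ps) w) ≡ inDeg S w
    remove-path {w = w} {S = S} {ps = ps} w≢root flow ps-walk ps⊆S = flow′ , value′
      where
      open IsFlow flow
      unique-ps : Unique (map edge (map bwd ps))
      unique-ps with acyclic⇒path acyclic ps-walk
      ... | _ ∷ heads-unique = subst Unique (sym (edges-bwd ps)) (Unique.map⁻ heads-unique)
      balance : AddsUnit S (S ∖ ps) w root
      balance = applyAll-balance S S (bwd-walk ps-walk) (All.map⁺ ps⊆S) unique-ps
      sink′ : outDeg (S ∖ ps) w ≡ 0
      sink′ = n≤0⇒n≡0 (subst (outDeg (S ∖ ps) w ≤_) sink (count-mono (λ e e∈ →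
        cong₂ _∧_ (∖-⊆ S ps e (∧-conicalˡ _ _ e∈)) (∧-conicalʳ ((S ∖ ps) e) _ e∈))))
      root≠w : (root == w) ≡ false
      root≠w = ≢⇒==-false (w≢root ∘ sym)
      flow′ : IsFlow w (S ∖ ps)
      flow′ = record
        { conserved = λ x x≢root x≢w → AddsUnit-conserved balance x≢w x≢root (conserved x x≢root x≢w)
        ; sink      = sink′
        }
      value′ : suc (inDeg (S ∖ ps) w) ≡ inDeg S w
      value′ = begin
        suc (inDeg (S ∖ ps) w)             ≡⟨ +-comm 1 _ ⟩
        inDeg (S ∖ ps) w + 1               ≡⟨ cong (λ b → inDeg (S ∖ ps) w + bit b) (==-refl w) ⟨
        inDeg (S ∖ ps) w + bit (w == w)    ≡⟨ AddsUnit-at-sink balance sink sink′ ⟩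
        inDeg S w + bit (root == w)        ≡⟨ cong (λ b → inDeg S w + bit b) root≠w ⟩
        inDeg S w + 0                      ≡⟨ +-identityʳ _ ⟩
        inDeg S w                          ∎
        where open ≡-Reasoning

    flow-decomposition : ∀ {S} → w ≢ root → IsFlow w S → ∀ k → inDeg S w ≡ k → Walks S w k
    flow-decomposition w≢root flow zero _ =
      record { walk = λ () ; isWalk = λ () ; inside = λ () ; disjoint = λ () }
    flow-decomposition {S = S} w≢root flow (suc k) value≡k+1
      with positive-flow⇒walk flow (subst (0 <_) (sym value≡k+1) (s≤s z≤n))
    ... | ps , ps-walk , ps⊆S with remove-path w≢root flow ps-walk ps⊆S
    ...   | flow′ , value′ = Walks-cons ps-walk ps⊆S (∖-⊆ S ps) (∖-removes S ps)
      (flow-decomposition w≢root flow′ k (suc-injective (trans value′ value≡k+1)))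

    menger : ∀ G → w ≢ root → ∀ j → Walks G w j ⊎ ∃ λ U → Separates w U × cut G U < j
    menger {w = w} G w≢root j with max-flow-min-cut G w w≢root
    ... | record { flow = S ; flow⊆G = S⊆G ; isFlow = flow ; cutSet = U ; separates = sep ; cut≤value = cut≤ }
      with j ≤? inDeg S w
    ... | yes j≤value = inj₁ (Walks-take j≤value (Walks-mono S⊆G (flow-decomposition w≢root flow _ refl)))
    ... | no  j≰value = inj₂ (U , sep , ≤-<-trans cut≤ (≰⇒> j≰value))

    module MaximalLinked (u : Vertex n) (u≢root : u ≢ root) (B : EdgeSet) (linked : Linked allEdges u B)
      (maximal : ∀ e → head e ≡ u → B e ≡ false → ¬ Linked allEdges u (B ∪⁅ e ⁆)) where

      Gᴮ : EdgeSet
      Gᴮ = restrictInto allEdges u B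

      Tight : VertexSet → Set
      Tight U = Separates u U × cut Gᴮ U ≤ count B

      tight-point : Tight (_== u)
      tight-point = (==-refl u , ≢⇒==-false (u≢root ∘ sym)) , count-mono entering⇒B
        where
        entering⇒B : (Gᴮ ∩ enters (_== u)) ⊆ B
        entering⇒B e e∈ with head e == u | B e | tail e == u
        ... | true  | true  | _ = refl
        entering⇒B e () | true  | false | true
        entering⇒B e () | true  | false | false
        entering⇒B e () | false | _     | true
        entering⇒B e () | false | _     | false

      tight-∪ : ∀ {U W} → Tight U → Tight W → Tight (U ∪ W)
      tight-∪ {U} {W} ((Uu , Uroot) , cutU) ((Wu , Wroot) , cutW) =
        (cong (_∨ W u) Uu , cong₂ _∨_ Uroot Wroot) ,
        +-cancelˡ-≤ (count B) _ _ (begin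
          count B + cut Gᴮ (U ∪ W)
            ≤⟨ +-monoˡ-≤ _ (walks≤cut linked (U ∩ W) (cong₂ _∧_ Uu Wu , cong (_∧ W root) Uroot)) ⟩
          cut Gᴮ (U ∩ W) + cut Gᴮ (U ∪ W)      ≤⟨ cut-submodular Gᴮ U W ⟩
          cut Gᴮ U + cut Gᴮ W                  ≤⟨ +-mono-≤ cutU cutW ⟩
          count B + count B                      ∎)
        where open ≤-Reasoning

      tight-around : ∀ e → head e ≡ u → B e ≡ false → ∃ λ U → Tight U × U (tail e) ≡ true
      tight-around e he≡u Be with menger (restrictInto allEdges u (B ∪⁅ e ⁆)) u≢root (suc (count B))
      ... | inj₁ walks = ⊥-elim (maximal e he≡u Be (subst (Walks _ u) (sym (count-insert B Be)) walks))
      ... | inj₂ (U , sep , cut<) = U , (sep , cutᴮ≤) , tail∈U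
        where
        Gᵉ : EdgeSet
        Gᵉ = restrictInto allEdges u (B ∪⁅ e ⁆)
        Gᴮ⊆Gᵉ : Gᴮ ⊆ Gᵉ
        Gᴮ⊆Gᵉ = restrictInto-mono (λ f Bf → cong (_∨ (f == e)) Bf)
        cutᴮ≤ : cut Gᴮ U ≤ count B
        cutᴮ≤ = ≤-pred (≤-<-trans (cut-mono Gᴮ⊆Gᵉ U) cut<)
        tail∈U : U (tail e) ≡ true
        tail∈U with U (tail e) in Utail
        ... | true  = refl
        ... | false = ⊥-elim (<-irrefl refl (≤-trans (cut-drop Gᴮ⊆Gᵉ U e e∉Gᴮ e∈Gᵉ e-enters)
                        (≤-trans (≤-pred cut<) (walks≤cut linked U sep))))
          where
          e∉Gᴮ : Gᴮ e ≡ false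
          e∉Gᴮ rewrite he≡u | ==-refl u | Be = refl
          e∈Gᵉ : Gᵉ e ≡ true
          e∈Gᵉ rewrite ==-refl e | ∨-zeroʳ (B e) = ∨-zeroʳ _
          e-enters : enters U e ≡ true
          e-enters rewrite Utail | he≡u = proj₁ sep

      tight-at : ∀ e → ∃ λ U → Tight U × (head e ≡ u → B e ≡ false → U (tail e) ≡ true)
      tight-at e with head e ≟ u | B e in Be
      ... | yes he≡u | false = let U , tight , tail∈ = tight-around e he≡u Be in U , tight , λ _ _ → tail∈
      ... | yes _    | true  = (_== u) , tight-point , λ _ ()
      ... | no he≢u  | _     = (_== u) , tight-point , λ he≡u → ⊥-elim (he≢u he≡u)

      tight-cover : ∀ (L : List (Fin m)) →
        ∃ λ U → Tight U × (∀ e → e ∈ L → head e ≡ u → B e ≡ false → U (tail e) ≡ true)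
      tight-cover []      = (_== u) , tight-point , λ _ ()
      tight-cover (e ∷ L) =
        let U , tightU , covers = tight-cover L
            Uₑ , tightUₑ , coversₑ = tight-at e
        in U ∪ Uₑ , tight-∪ {U} {Uₑ} tightU tightUₑ , λ
          { f (here refl) he≡u Bf → trans (cong (U (tail f) ∨_) (coversₑ he≡u Bf)) (∨-zeroʳ _)
          ; f (there f∈)  he≡u Bf → cong (_∨ Uₑ (tail f)) (covers f f∈ he≡u Bf)
          }

      walks≤count : ∀ k → Walks allEdges u k → k ≤ count B
      walks≤count k walks with tight-cover (allFin m)
      ... | U , ((Uu , Uroot) , cut≤) , covers =
        ≤-trans (walks≤cut walks U (Uu , Uroot)) (≤-trans (count-mono entering⊆Gᴮ) cut≤)
        where
        entering⊆Gᴮ : (allEdges ∩ enters U) ⊆ (Gᴮ ∩ enters U)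
        entering⊆Gᴮ e e-enters with head e ≟ u
        ... | no _ = e-enters
        ... | yes he≡u with B e in Be
        ...   | true = e-enters
        ...   | false with () ← trans (sym e-enters)
                                    (cong (λ b → not b ∧ U (head e)) (covers e (∈-allFin e) he≡u Be))

    module EdgeDeletion {H : EdgeSet} {f : Fin m} (Hf : H f ≡ true) (u≢root : head f ≢ root)
      {ku : ℕ} (walks-u : Walks (H - f) (head f) ku) (max-u : ∀ k → Walks H (head f) k → k ≤ ku)
      {w : Vertex n} {X : EdgeSet} (w≢root : w ≢ root) (w≢u : w ≢ head f) (linked : Linked H w X) where

      Gˣ Gˣ-f : EdgeSet
      Gˣ   = restrictInto H w X
      Gˣ-f = restrictInto (H - f) w X

      Gˣ-f⊆H : Gˣ-f ⊆ H
      Gˣ-f⊆H e e∈ = p-x⊆p H f e (∧-conicalˡ ((H - f) e) _ e∈)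

      f-enters-small-cuts : ∀ U → Separates w U → cut Gˣ-f U < count X → enters U f ≡ true
      f-enters-small-cuts U sep cut< with enters U f in f-enters
      ... | true  = refl
      ... | false = ⊥-elim (<-irrefl refl (≤-<-trans (≤-trans (walks≤cut linked U sep) (count-mono kept)) cut<))
        where
        kept : (Gˣ ∩ enters U) ⊆ (Gˣ-f ∩ enters U)
        kept e e∈ =
          cong₂ _∧_ (restrictInto-delete H w X (∧-conicalˡ (Gˣ e) _ e∈) e≢f) (∧-conicalʳ (Gˣ e) _ e∈)
          where
          e≢f : e ≢ f
          e≢f refl = not-¬ (∧-conicalʳ (Gˣ e) _ e∈) f-enters

      cut-at-u : ∃ λ W → Separates (head f) W × cut H W ≤ ku × W (tail f) ≡ true
      cut-at-u with menger H u≢root (suc ku)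
      ... | inj₁ walks = ⊥-elim (<-irrefl refl (max-u (suc ku) walks))
      ... | inj₂ (W , sep , cut<) = W , sep , ≤-pred cut< , tail∈W
        where
        tail∈W : W (tail f) ≡ true
        tail∈W with W (tail f) in Wtail
        ... | true  = refl
        ... | false = ⊥-elim (<-irrefl refl (≤-<-trans (walks≤cut walks-u W sep)
                        (<-≤-trans (cut-drop (p-x⊆p H f) W f (x∉p-x H f) Hf f-enters) (≤-pred cut<))))
          where
          f-enters : enters W f ≡ true
          f-enters rewrite Wtail = proj₁ sep

      no-small-cut : ∀ {ps} → IsWalk D (head f) ps w → ∀ U → Separates w U → cut Gˣ-f U < count X → ⊥
      no-small-cut u⇝w U (Uw , Uroot) cut< with cut-at-u
      ... | W , (Wu , Wroot) , cutW≤ , tail∈W = <-irrefl refl (begin-strict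
        ku + count X                         ≤⟨ +-mono-≤ ku≤cut∩ X≤cut∪ ⟩
        cut Gˣ-f (U ∩ W) + cut Gˣ-f (U ∪ W)  ≤⟨ cut-submodular Gˣ-f U W ⟩
        cut Gˣ-f U + cut Gˣ-f W              ≤⟨ +-monoʳ-≤ _ (≤-trans (cut-mono Gˣ-f⊆H W) cutW≤) ⟩
        cut Gˣ-f U + ku                      <⟨ +-monoˡ-< ku cut< ⟩
        count X + ku                         ≡⟨ +-comm (count X) ku ⟩
        ku + count X                         ∎)
        where
        open ≤-Reasoning
        Uu : U (head f) ≡ true
        Uu = ∧-conicalʳ (not (U (tail f))) _ (f-enters-small-cuts U (Uw , Uroot) cut<)
        ku≤cut∩ : ku ≤ cut Gˣ-f (U ∩ W)
        ku≤cut∩ = walks≤cut-by walks-u (U ∩ W) (cong₂ _∧_ Uu Wu , cong (_∧ W root) Uroot) Gˣ-f kept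
          where
          kept : ∀ e → (H - f) e ≡ true → enters (U ∩ W) e ≡ true →
            (∃ λ fs → IsWalk D (head e) fs (head f)) → Gˣ-f e ≡ true
          kept e e∈ _ (_ , e⇝u) with head e ≟ w
          ... | yes refl = ⊥-elim (acyclic⇒no-return acyclic e⇝u w≢u u⇝w)
          ... | no _     = trans (∧-identityʳ _) e∈
        f-inside : enters (U ∪ W) f ≡ false
        f-inside rewrite tail∈W | ∨-zeroʳ (U (tail f)) = refl
        X≤cut∪ : count X ≤ cut Gˣ-f (U ∪ W)
        X≤cut∪ = walks≤cut-by linked (U ∪ W) (cong (_∨ W w) Uw , cong₂ _∨_ Uroot Wroot) Gˣ-f
          (λ e e∈ e-enters _ → restrictInto-delete H w X e∈ λ { refl → not-¬ e-enters f-inside })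

      Linked-after-deletion : Linked (H - f) w X
      Linked-after-deletion with any? (λ i → anyᴸ? (f ≟_) (Walks.walk linked i))
      ... | no f∉walks = Walks-avoid linked (λ i f∈ → f∉walks (i , f∈)) (λ e → restrictInto-delete H w X)
      ... | yes (i , f∈) with menger Gˣ-f w≢root (count X)
      ...   | inj₁ walks = walks
      ...   | inj₂ (U , sep , cut<) =
        ⊥-elim (no-small-cut (proj₂ (walk-from-head (Walks.isWalk linked i) f∈)) U sep cut<)

    HasPaths⇒Walks : ∀ {H : Subset m} → HasPaths D H w k → Walks (lookup H) w k
    HasPaths⇒Walks (P , paths , disjoint) = record
      { walk     = P
      ; isWalk   = proj₁ ∘ proj₁ ∘ paths
      ; inside   = All.map []=⇒lookup ∘ proj₂ ∘ paths
      ; disjoint = disjoint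
      }

    Walks⇒HasPaths : ∀ {H : Subset m} → G ⊆ lookup H → Walks G w k → HasPaths D H w k
    Walks⇒HasPaths {H = H} G⊆H P =
      walk , (λ i → isPath i , All.map (λ {e} → lookup⇒[]= e H ∘ G⊆H e) (inside i)) , disjoint
      where
      open Walks P
      isPath : ∀ i → IsPath D root (walk i) _
      isPath i = isWalk i , acyclic⇒path acyclic (isWalk i)

    module FinalEdges {G X : EdgeSet} {v : Vertex n} (v≢root : v ≢ root) (P : Walks (restrictInto G v X) v k) where
      open Walks P

      final : ∀ i → ∃ λ e → last (walk i) ≡ just e × X e ≡ true × e ∈ walk i
      final i with walk i | isWalk i | inside i
      ... | []     | nil | _   = ⊥-elim (v≢root refl)
      ... | _ ∷ _  | p   | p⊆G with last-edge p
      ...   | e , last≡e , he≡v , e∈ = e , last≡e , restrictInto-at-v G v X (All.lookup p⊆G e∈) he≡v , e∈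

      finalEdge : Fin k → Fin m
      finalEdge i = proj₁ (final i)

      finalEdge-last : ∀ i → last (walk i) ≡ just (finalEdge i)
      finalEdge-last i = proj₁ (proj₂ (final i))

      finalEdge∈X : ∀ i → X (finalEdge i) ≡ true
      finalEdge∈X i = proj₁ (proj₂ (proj₂ (final i)))

      finalEdge∈walk : ∀ i → finalEdge i ∈ walk i
      finalEdge∈walk i = proj₂ (proj₂ (proj₂ (final i)))

      X⊆finalEdges : count X ≤ k → ∀ e → X e ≡ true → ∃ λ i → finalEdge i ≡ e
      X⊆finalEdges X≤k e Xe with any? (λ i → finalEdge i ≟ e)
      ... | yes found   = found
      ... | no e∉finals = ⊥-elim (<-irrefl refl (≤-trans (subst (_≤ k) (count-remove X Xe) X≤k)
                            (injective⇒≤count (X - e) finalEdge finalEdge-injective finalEdge∈X-e)))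
        where
        finalEdge-injective : ∀ {i j} → finalEdge i ≡ finalEdge j → i ≡ j
        finalEdge-injective {i} {j} same with i ≟ j
        ... | yes i≡j = i≡j
        ... | no i≢j  =
          ⊥-elim (disjoint i j i≢j (finalEdge∈walk i , subst (_∈ walk j) (sym same) (finalEdge∈walk j)))
        finalEdge∈X-e : ∀ i → (X - e) (finalEdge i) ≡ true
        finalEdge∈X-e i = cong₂ (λ a b → a ∧ not b) (finalEdge∈X i) (≢⇒==-false (e∉finals ∘ (i ,_)))

    lookup-inD : ∀ v e → lookup (inD D v) e ≡ (head e == v)
    lookup-inD v e = lookup∘tabulate _ e

    IndepG⇒Linked : ∀ {v Xs} → IndepG D v Xs → Linked allEdges (suc v) (lookup Xs)
    IndepG⇒Linked {v} {Xs} (_ , P , (paths , disjoint) , X⇔final) = subst (Walks _ (suc v)) (∣X∣≡count Xs) (record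
      { walk = P ; isWalk = isWalk ; inside = λ i → All.tabulate (enters-through-X i) ; disjoint = disjoint })
      where
      isWalk : ∀ i → IsWalk D root (P i) (suc v)
      isWalk i = proj₁ (proj₁ (paths i))
      enters-through-X : ∀ i {e} → e ∈ P i → restrictInto allEdges (suc v) (lookup Xs) e ≡ true
      enters-through-X i {e} e∈ with head e ≟ suc v
      ... | no _     = refl
      ... | yes he≡v =
        []=⇒lookup (Equivalence.from (X⇔final e) (i , path-last (isWalk i) (proj₂ (proj₁ (paths i))) e∈ he≡v))

    Linked⇒IndepG : ∀ {v Xs} → (∀ e → lookup Xs e ≡ true → head e ≡ suc v) →
      Linked allEdges (suc v) (lookup Xs) → IndepG D v Xs
    Linked⇒IndepG {v} {Xs} X⊆in linked = X⊆inD , walk , (paths , disjoint) , X⇔final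
      where
      P : Walks (restrictInto allEdges (suc v) (lookup Xs)) (suc v) ∣ Xs ∣
      P = subst (Walks _ (suc v)) (sym (∣X∣≡count Xs)) linked
      open Walks P
      open FinalEdges (λ ()) P
      paths : ∀ i → IsPathIn D (E D) (walk i) (suc v)
      paths i = (isWalk i , acyclic⇒path acyclic (isWalk i)) , All.tabulate (λ _ → ∈⊤)
      X⊆inD : Xs S.⊆ inD D (suc v)
      X⊆inD {e} e∈ = lookup⇒[]= e _ (trans (lookup-inD (suc v) e) (≡⇒== (X⊆in e ([]=⇒lookup e∈))))
      X⇔final : ∀ e → (e S.∈ Xs) ⇔ (∃ λ i → last (walk i) ≡ just e)
      X⇔final e = mk⇔ to from
        where
        to : e S.∈ Xs → ∃ λ i → last (walk i) ≡ just e
        to e∈ with X⊆finalEdges (≤-reflexive (sym (∣X∣≡count Xs))) e ([]=⇒lookup e∈)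
        ... | i , refl = i , finalEdge-last i
        from : (∃ λ i → last (walk i) ≡ just e) → e S.∈ Xs
        from (i , last≡e) = lookup⇒[]= e Xs
          (subst (λ f → lookup Xs f ≡ true) (just-injective (trans (sym (finalEdge-last i)) last≡e))
                 (finalEdge∈X i))

    -- Maximal flames and bases of ℳ

    module _ (no-root : ∀ e → head e ≢ root) (F : Subset m) where

      _at_ : Subset m → Fin n → EdgeSet
      Y at v = lookup (Y S.∩ inD D (suc v))

      at-≡ : ∀ Y v e → (Y at v) e ≡ lookup Y e ∧ (head e == suc v)
      at-≡ Y v e = trans (lookup-zipWith _∧_ e Y (inD D (suc v))) (cong (lookup Y e ∧_) (lookup-inD (suc v) e))

      at-head : ∀ Y v e → (Y at v) e ≡ true → head e ≡ suc v
      at-head Y v e e∈ = ==⇒≡ (∧-conicalʳ (lookup Y e) _ (trans (sym (at-≡ Y v e)) e∈))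

      at-∈ : ∀ {Y v e} → (Y at v) e ≡ true → e S.∈ Y
      at-∈ {Y} {v} {e} e∈ = lookup⇒[]= e Y (∧-conicalˡ (lookup Y e) _ (trans (sym (at-≡ Y v e)) e∈))

      ∈-at-head : ∀ {Y v e} → e S.∈ Y → head e ≡ suc v → (Y at v) e ≡ true
      ∈-at-head {Y} {v} {e} e∈Y he≡v = trans (at-≡ Y v e) (cong₂ _∧_ ([]=⇒lookup e∈Y) (≡⇒== he≡v))

      at-mono : ∀ {Y Y′} → Y S.⊆ Y′ → ∀ v → (Y at v) ⊆ (Y′ at v)
      at-mono {Y} Y⊆Y′ v e e∈ = ∈-at-head (Y⊆Y′ (at-∈ {Y} {v} e∈)) (at-head Y v e e∈)

      indeg≡count : ∀ v → indeg D F (suc v) ≡ count (F at v)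
      indeg≡count v = ∣X∣≡count (F S.∩ inD D (suc v))

      head-vertex : ∀ e → ∃ λ v → head e ≡ suc v
      head-vertex e with head e in he
      ... | zero  = ⊥-elim (no-root e he)
      ... | suc v = v , refl

      ∈Ground : ∀ e → e S.∈ Ground D
      ∈Ground e with head-vertex e
      ... | v , he≡v = ∈⋃ (∈-map⁺ (λ v → inD D (suc v)) (∈-allFin v))
                          (lookup⇒[]= e _ (trans (lookup-inD (suc v) e) (≡⇒== he≡v)))

      ⊆E : G ⊆ lookup (E D)
      ⊆E e _ = []=⇒lookup (∈⊤ {x = e})

      flame⇒base : MaximalFlame D F → IsBaseM D F
      flame⇒base (_ , λ≡indeg) =
        ((λ {e} _ → ∈Ground e) , λ v → Linked⇒IndepG (at-head F v) (F-linked v)) , maximal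
        where
        F-linked : ∀ v → Linked allEdges (suc v) (F at v)
        F-linked v = subst (Walks _ (suc v)) (indeg≡count v)
          (Walks-mono F⊆restricted (HasPaths⇒Walks (proj₁ (proj₂ (λ≡indeg v)))))
          where
          F⊆restricted : lookup F ⊆ restrictInto allEdges (suc v) (F at v)
          F⊆restricted e Fe with head e ≟ suc v
          ... | no _     = refl
          ... | yes he≡v = ∈-at-head (lookup⇒[]= e F Fe) he≡v
        maximal : ∀ Y → IndepM D Y → F S.⊆ Y → Y S.⊆ F
        maximal Y (_ , Y-indep) F⊆Y {e} e∈Y with head-vertex e
        ... | v , he≡v = at-∈ {v = v} (p⊆q∧∣q∣≤∣p∣⇒q⊆p (at-mono F⊆Y v) Yᵥ≤Fᵥ e (∈-at-head e∈Y he≡v))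
          where
          Yᵥ≤Fᵥ : count (Y at v) ≤ count (F at v)
          Yᵥ≤Fᵥ = subst (_ ≤_) (indeg≡count v)
            (proj₂ (proj₁ (λ≡indeg v)) _ (Walks⇒HasPaths ⊆E (IndepG⇒Linked (Y-indep v))))

      module _ (base : IsBaseM D F) where

        F-linked : ∀ v → Linked allEdges (suc v) (F at v)
        F-linked v = IndepG⇒Linked (proj₂ (proj₁ base) v)

        F-maximal : ∀ v e → head e ≡ suc v → (F at v) e ≡ false →
          ¬ Linked allEdges (suc v) ((F at v) ∪⁅ e ⁆)
        F-maximal v e he≡v Fᵥe linked-e = not-¬ (∈-at-head (proj₂ base Y Y-indep F⊆Y e∈Y) he≡v) Fᵥe
          where
          Y : Subset m
          Y = Data.Vec.tabulate (lookup F ∪⁅ e ⁆)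
          lookup-Y : ∀ x → lookup Y x ≡ (lookup F x ∨ (x == e))
          lookup-Y = lookup∘tabulate (lookup F ∪⁅ e ⁆)
          Y-at-v : ∀ x → ((F at v) ∪⁅ e ⁆) x ≡ (Y at v) x
          Y-at-v x rewrite at-≡ F v x | at-≡ Y v x | lookup-Y x with x ≟ e
          ... | yes refl rewrite he≡v | ==-refl (suc v) | ∨-zeroʳ (lookup F x) = ∨-zeroʳ _
          ... | no _ = trans (∨-identityʳ _) (cong (_∧ (head x == suc v)) (sym (∨-identityʳ _)))
          Y-at-other : ∀ v′ → v′ ≢ v → ∀ x → (F at v′) x ≡ (Y at v′) x
          Y-at-other v′ v′≢v x rewrite at-≡ F v′ x | at-≡ Y v′ x | lookup-Y x with x ≟ e
          ... | yes refl rewrite he≡v | ≢⇒==-false (v′≢v ∘ sym ∘ Fin.suc-injective) =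
            trans (∧-zeroʳ _) (sym (∧-zeroʳ _))
          ... | no _     = cong (_∧ (head x == suc v′)) (sym (∨-identityʳ _))
          Y-linked : ∀ v′ → Linked allEdges (suc v′) (Y at v′)
          Y-linked v′ with v′ ≟ v
          ... | yes refl = Linked-cong Y-at-v linked-e
          ... | no v′≢v  = Linked-cong (Y-at-other v′ v′≢v) (F-linked v′)
          Y-indep : IndepM D Y
          Y-indep = (λ {x} _ → ∈Ground x) , λ v′ → Linked⇒IndepG (at-head Y v′) (Y-linked v′)
          F⊆Y : F S.⊆ Y
          F⊆Y {x} x∈F = lookup⇒[]= x Y (trans (lookup-Y x) (cong (_∨ (x == e)) ([]=⇒lookup x∈F)))
          e∈Y : e S.∈ Y
          e∈Y = lookup⇒[]= e Y (trans (lookup-Y e) (trans (cong (lookup F e ∨_) (==-refl e)) (∨-zeroʳ _)))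

        F-rank : ∀ v k → Walks allEdges (suc v) k → k ≤ count (F at v)
        F-rank v = MaximalLinked.walks≤count (suc v) (λ ()) (F at v) (F-linked v) (F-maximal v)

        AttainsLambda : EdgeSet → Set
        AttainsLambda H = ∀ v → Linked H (suc v) (F at v) × (∀ k → Walks H (suc v) k → k ≤ count (F at v))

        AttainsLambda-resp : ∀ {H H′} → H ⊆ H′ → H′ ⊆ H → AttainsLambda H → AttainsLambda H′
        AttainsLambda-resp H⊆H′ H′⊆H attains v =
          Walks-mono (restrictInto-monoˡ H⊆H′) (proj₁ (attains v)) ,
          λ k → proj₂ (attains v) k ∘ Walks-mono H′⊆H

        AttainsLambda-delete : ∀ {H} → AttainsLambda H → ∀ f → lookup F f ≡ false → AttainsLambda (H - f)
        AttainsLambda-delete {H} attains f Ff with H f in Hf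
        ... | false = AttainsLambda-resp H⊆H-f (p-x⊆p H f) attains
          where
          H⊆H-f : H ⊆ (H - f)
          H⊆H-f e He with e ≟ f
          ... | yes refl with () ← trans (sym Hf) He
          ... | no _     = trans (∧-identityʳ (H e)) He
        ... | true with head-vertex f
        ...   | v₀ , hf≡v₀ = λ v → linked-after v , λ k → proj₂ (attains v) k ∘ Walks-mono (p-x⊆p H f)
          where
          f∉Fᵥ₀ : (F at v₀) f ≡ false
          f∉Fᵥ₀ = trans (at-≡ F v₀ f) (cong (_∧ (head f == suc v₀)) Ff)
          linked-v₀ : Linked (H - f) (suc v₀) (F at v₀)
          linked-v₀ = Walks-mono (λ e e∈ → restrictInto-delete H (suc v₀) (F at v₀) e∈ λ { refl →
            not-¬ (restrictInto-at-v H (suc v₀) (F at v₀) e∈ hf≡v₀) f∉Fᵥ₀ }) (proj₁ (attains v₀))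
          walks-u : Walks (H - f) (head f) (count (F at v₀))
          walks-u = subst (λ x → Walks (H - f) x (count (F at v₀))) (sym hf≡v₀)
            (Walks-mono (restrictInto⊆ {G = H - f} {v = suc v₀} {X = F at v₀}) linked-v₀)
          max-u : ∀ k → Walks H (head f) k → k ≤ count (F at v₀)
          max-u k = proj₂ (attains v₀) k ∘ subst (λ x → Walks H x k) hf≡v₀
          linked-after : ∀ v → Linked (H - f) (suc v) (F at v)
          linked-after v with v ≟ v₀
          ... | yes refl = linked-v₀
          ... | no v≢v₀  = EdgeDeletion.Linked-after-deletion Hf (no-root f) walks-u max-u
                             (λ ()) (λ eq → v≢v₀ (Fin.suc-injective (trans eq hf≡v₀))) (proj₁ (attains v))

        prune : List (Fin m) → EdgeSet
        prune []       = allEdges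
        prune (f ∷ fs) = if lookup F f then prune fs else prune fs - f

        prune-attains : ∀ fs → AttainsLambda (prune fs)
        prune-attains []       v = F-linked v , F-rank v
        prune-attains (f ∷ fs) with lookup F f in Ff
        ... | true  = prune-attains fs
        ... | false = AttainsLambda-delete (prune-attains fs) f Ff

        F⊆prune : ∀ fs → lookup F ⊆ prune fs
        F⊆prune []       e _  = refl
        F⊆prune (f ∷ fs) e Fe with lookup F f in Ff
        ... | true  = F⊆prune fs e Fe
        ... | false with e ≟ f
        ...   | yes refl with () ← trans (sym Ff) Fe
        ...   | no _     = trans (∧-identityʳ _) (F⊆prune fs e Fe)

        prune-drops : ∀ fs e → e ∈ fs → lookup F e ≡ false → prune fs e ≡ false
        prune-drops (f ∷ fs) e e∈ Fe with lookup F f in Ff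
        prune-drops (f ∷ fs) e (here refl) Fe | true with () ← trans (sym Ff) Fe
        prune-drops (f ∷ fs) e (there e∈)  Fe | true  = prune-drops fs e e∈ Fe
        prune-drops (f ∷ fs) e (here refl) Fe | false = x∉p-x (prune fs) e
        prune-drops (f ∷ fs) e (there e∈)  Fe | false rewrite prune-drops fs e e∈ Fe = refl

        F-attains : AttainsLambda (lookup F)
        F-attains = AttainsLambda-resp prune⊆F (F⊆prune (allFin m)) (prune-attains (allFin m))
          where
          prune⊆F : prune (allFin m) ⊆ lookup F
          prune⊆F e e∈ with lookup F e in Fe
          ... | true  = refl
          ... | false = ⊥-elim (not-¬ e∈ (prune-drops (allFin m) e (∈-allFin e) Fe))

        base⇒flame : MaximalFlame D F
        base⇒flame = (λ _ → ∈⊤) , λ v → subst (λ k → IsLambda D (E D) (suc v) k × IsLambda D F (suc v) k)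
                                              (sym (indeg≡count v)) (λ-in-D v , λ-in-F v)
          where
          λ-in-D : ∀ v → IsLambda D (E D) (suc v) (count (F at v))
          λ-in-D v = Walks⇒HasPaths ⊆E (F-linked v) ,
                     λ k → F-rank v k ∘ Walks-mono (λ _ _ → refl) ∘ HasPaths⇒Walks
          λ-in-F : ∀ v → IsLambda D F (suc v) (count (F at v))
          λ-in-F v = Walks⇒HasPaths restrictInto⊆ (proj₁ (F-attains v)) ,
                     λ k → proj₂ (F-attains v) k ∘ HasPaths⇒Walks

corollary1 : ∀ {n m : ℕ} (D : Digraph n m) → Acyclic D →
    (∀ (e : Fin m) → Digraph.head D e ≢ root) →
    ∀ (F : Subset m) → MaximalFlame D F ⇔ IsBaseM D F
corollary1 D acyclic no-root F = mk⇔ (flame⇒base D acyclic no-root F) (base⇒flame D acyclic no-root F)
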